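{- Let $0<|q|<1$ and $a\in\mathbb{C}$. Then $${}_{3}\phi_{2}\left(\begin{array}{c} a,b,c \\ 0,0\end{array};q,z\right)=\frac{(az;q)_{\infty}(b;q)_{\infty}(c;q)_{\infty}}{(z;q)_{\infty}}\sum_{n=0}^{\infty}\mathrm{h}_{n}(c/b|q)\frac{(z;q)_{n}}{(az;q)_{n}(q;q)_{n}}b^{n},$$ where $\mathrm{h}_{n}(c/b|q)\,b^{n}=\sum_{k=0}^{n}\genfrac{[}{]}{0pt}{}{n}{k}_{q}c^{k}b^{n-k}$.
   Context: $(a;q)_n=\prod_{k=0}^{n-1}(1-aq^k)$ (so $(0;q)_n=1$), $(a;q)_\infty=\prod_{k\ge0}(1-aq^k)$, $\genfrac{[}{]}{0pt}{}{n}{k}_{q}=\frac{(q;q)_n}{(q;q)_k(q;q)_{n-k}}$. The Rogers–Szeg\"o polynomial is $\mathrm{h}_{n}(x|q)=\sum_{k=0}^{n}\genfrac{[}{]}{0pt}{}{n}{k}_{q}x^{k}$. The basic hypergeometric series is ${}_{r}\phi_{s}\left(\begin{array}{c} a_1,\ldots,a_r \\ b_1,\ldots,b_s\end{array};q,z\right)=\sum_{n\ge0}\frac{(a_1;q)_n\cdots(a_r;q)_n}{(q;q)_n(b_1;q)_n\cdots(b_s;q)_n}\big[(-1)^nq^{\binom{n}{2}}\big]^{1+s-r}z^n$; in particular ${}_{3}\phi_{2}\left(\begin{array}{c} a,b,c \\ 0,0\end{array};q,z\right)=\sum_{n\ge0}\frac{(a;q)_n(b;q)_n(c;q)_n}{(q;q)_n}z^n$.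 The identity is understood as an identity of formal power series in $b$, $c$, $z$. -}

module Defs where

open import Data.Nat using (ℕ; zero; suc; _∸_) renaming (_+_ to _+ℕ_)
open import Algebra.Bundles using (CommutativeRing)

-- Formal power series in the four variables q, b, c, z over a commutative
-- ring R.  A series is its coefficient function: f i j k l is the
-- coefficient of q^i b^j c^k z^l.
module Series {c ℓ} (R : CommutativeRing c ℓ) where
  open CommutativeRing R renaming (Carrier to K)

  Σ≤ : ℕ → (ℕ → K) → K
  Σ≤ zero    f = f 0
  Σ≤ (suc n) f = Σ≤ n f + f (suc n)

  PS : Set c
  PS = ℕ → ℕ → ℕ → ℕ → K

  _≋_ : PS → PS → Set ℓ
  f ≋ g = ∀ i j k l → f i j k l ≈ g i j k l

  δ : ℕ → ℕ → K
  δ zero    zero    = 1#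
  δ zero    (suc _) = 0#
  δ (suc _) zero    = 0#
  δ (suc m) (suc n) = δ m n

  mono : K → ℕ → ℕ → ℕ → ℕ → PS
  mono r e₁ e₂ e₃ e₄ i j k l = r * (δ e₁ i * (δ e₂ j * (δ e₃ k * δ e₄ l)))

  const : K → PS
  const r = mono r 0 0 0 0

  𝟙 𝐪 𝐛 𝐜 𝐳 : PS
  𝟙 = const 1#
  𝐪 = mono 1# 1 0 0 0
  𝐛 = mono 1# 0 1 0 0
  𝐜 = mono 1# 0 0 1 0
  𝐳 = mono 1# 0 0 0 1

  infixl 6 _⊕_ _⊖_
  infixl 7 _⊗_
  infixr 8 _^ᵖ_

  _⊕_ : PS → PS → PS
  (f ⊕ g) i j k l = f i j k l + g i j k l

  _⊖_ : PS → PS → PS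
  (f ⊖ g) i j k l = f i j k l - g i j k l

  _⊗_ : PS → PS → PS
  (f ⊗ g) i j k l =
    Σ≤ i λ i₁ → Σ≤ j λ j₁ → Σ≤ k λ k₁ → Σ≤ l λ l₁ →
      f i₁ j₁ k₁ l₁ * g (i ∸ i₁) (j ∸ j₁) (k ∸ k₁) (l ∸ l₁)

  _^ᵖ_ : PS → ℕ → PS
  f ^ᵖ zero  = 𝟙
  f ^ᵖ suc n = f ⊗ (f ^ᵖ n)

  ΣP≤ : ℕ → (ℕ → PS) → PS
  ΣP≤ zero    s = s 0
  ΣP≤ (suc n) s = ΣP≤ n s ⊕ s (suc n)

  ∏P< : ℕ → (ℕ → PS) → PS
  ∏P< zero    s = 𝟙
  ∏P< (suc n) s = ∏P< n s ⊗ s n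

  -- Infinite sum Σ_{n≥0} s n of a summable family, i.e. one in which the
  -- n-th term has total degree ≥ n (true for every use below): the
  -- coefficient of a monomial of total degree d only receives
  -- contributions from n ≤ d.
  Σ∞ : (ℕ → PS) → PS
  Σ∞ s i j k l = ΣP≤ (i +ℕ j +ℕ k +ℕ l) s i j k l

  -- Multiplicative inverse of a series with constant term 1:
  -- 1/f = Σ_{m≥0} (1 - f)^m  (the m-th term has total degree ≥ m).
  inv : PS → PS
  inv f = Σ∞ λ m → (𝟙 ⊖ f) ^ᵖ m

  poch : PS → ℕ → PS
  poch x n = ∏P< n λ k → 𝟙 ⊖ x ⊗ (𝐪 ^ᵖ k)

  -- (x;q)_∞ = ∏_{k≥0} (1 - x q^k) as a formal power series: the factors
  -- with k > i do not affect coefficients of q^i, so the coefficient of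
  -- q^i b^j c^k z^l is that of the finite product over k ≤ i.
  pochInf : PS → PS
  pochInf x i j k l = poch x (suc i) i j k l

  qbin : ℕ → ℕ → PS
  qbin n k = poch 𝐪 n ⊗ inv (poch 𝐪 k ⊗ poch 𝐪 (n ∸ k))

  -- h_n(c/b|q) b^n = Σ_{k=0}^n [n k]_q c^k b^{n-k}
  hb : ℕ → PS
  hb n = ΣP≤ n λ k → qbin n k ⊗ 𝐜 ^ᵖ k ⊗ 𝐛 ^ᵖ (n ∸ k)

  phi32 : PS → PS → PS → PS → PS
  phi32 A B C Z = Σ∞ λ n →
    poch A n ⊗ poch B n ⊗ poch C n ⊗ inv (poch 𝐪 n) ⊗ Z ^ᵖ n

  lhs : K → PS
  lhs a = phi32 (const a) 𝐛 𝐜 𝐳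

  rhs : K → PS
  rhs a =
    pochInf (const a ⊗ 𝐳) ⊗ pochInf 𝐛 ⊗ pochInf 𝐜 ⊗ inv (pochInf 𝐳)
    ⊗ Σ∞ (λ n → hb n ⊗ poch 𝐳 n ⊗ inv (poch (const a ⊗ 𝐳) n ⊗ poch 𝐪 n))

-- Identities involving infinite sums or products are proved modulo monomials of total degree ≥ N,
-- for every N: agreement below a given degree is a ring congruence, so ring reasoning applies
-- there, and the infinite sums and products become finite ones.
--
-- Write φ(A; x) = Σₙ (A;q)ₙ/(q;q)ₙ xⁿ. The q-binomial theorem (x;q)∞ φ(A; x) = (Ax;q)∞ follows by
-- iterating (1 - x) φ(A; x) = (1 - Ax) φ(A; xq) until xqᴺ is negligible. Its case A = 0 (Euler)
-- gives (b;q)ₙ = (b;q)∞ Σⱼ bʲ qⁿʲ/(q;q)ⱼ, and likewise for c, so the left side becomes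
-- (b;q)∞ (c;q)∞ Σ_{j,k} bʲ cᵏ/((q;q)ⱼ (q;q)ₖ) φ(a; z qʲ⁺ᵏ), where by the q-binomial theorem
-- φ(a; z qᵐ) = (az;q)∞/(z;q)∞ · (z;q)ₘ/(az;q)ₘ. On the right, hₘ(c/b|q) bᵐ/(q;q)ₘ is the sum of
-- bʲ cᵏ/((q;q)ⱼ (q;q)ₖ) over j + k = m, so it is the same double series summed along diagonals.

{-# OPTIONS --safe #-}
module Submission where

open import Algebra.Bundles using (CommutativeRing)
open import Algebra.Core using (Op₂)
open import Algebra.Definitions using (Congruent₁; Congruent₂)
import Algebra.Construct.Pointwise as Pointwise
import Algebra.Properties.CommutativeSemigroup as CommutativeSemigroupProperties
import Algebra.Properties.CommutativeSemiring.Exp as ExpProperties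
import Algebra.Properties.Ring as RingProperties
import Algebra.Solver.CommutativeMonoid as CommutativeMonoidSolver
open import Data.Nat using (ℕ; zero; suc; _∸_; _≤_; _<_; _≤′_; z≤n; s≤s; ≤′-refl; ≤′-step; _<?_)
  renaming (_+_ to _+ℕ_; _*_ to _*ℕ_)
import Data.Nat.Properties as ℕ
open import Data.Nat.Tactic.RingSolver using (solve-∀)
open import Data.Product using (_,_)
open import Relation.Binary.Core using (Rel; _⇒_)
open import Relation.Binary.Structures using (IsEquivalence)
open import Relation.Binary.PropositionalEquality as ≡ using (_≡_)
open import Relation.Nullary using (yes; no)
import Relation.Binary.Reasoning.Setoid as SetoidReasoning
open import Defs

module RingLemmas {c ℓ} (R : CommutativeRing c ℓ) where
  open CommutativeRing R
  open RingProperties ring public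
  open SetoidReasoning setoid

  x-0≈x : ∀ x → x - 0# ≈ x
  x-0≈x x = trans (+-congˡ -0#≈0#) (+-identityʳ x)

  1-[1-x]≈x : ∀ x → 1# - (1# - x) ≈ x
  1-[1-x]≈x x = begin
    1# - (1# - x)  ≈⟨ +-congˡ (⁻¹-anti-homo‿- 1# x) ⟩
    1# + (x - 1#)  ≈⟨ +-assoc 1# x (- 1#) ⟨
    1# + x - 1#    ≈⟨ xyx⁻¹≈y 1# x ⟩
    x              ∎

  [1-x]y≈y-xy : ∀ x y → (1# - x) * y ≈ y - x * y
  [1-x]y≈y-xy x y = trans ([y-z]x≈yx-zx y 1# x) (+-congʳ (*-identityˡ y))

  x[1-y]≈x-xy : ∀ x y → x * (1# - y) ≈ x - x * y
  x[1-y]≈x-xy x y = trans (x[y-z]≈xy-xz x 1# y) (+-congʳ (*-identityʳ x))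

  [x-y]+[y-z]≈x-z : ∀ x y z → (x - y) + (y - z) ≈ x - z
  [x-y]+[y-z]≈x-z x y z = begin
    (x - y) + (y - z)   ≈⟨ +-assoc x (- y) (y - z) ⟩
    x + (- y + (y - z)) ≈⟨ +-congˡ (+-assoc (- y) y (- z)) ⟨
    x + (- y + y - z)   ≈⟨ +-congˡ (+-congʳ (-‿inverseˡ y)) ⟩
    x + (0# - z)        ≈⟨ +-congˡ (+-identityˡ (- z)) ⟩
    x - z               ∎

  x-y≈z-w⇒x-z≈y-w : ∀ {x y z w} → x - y ≈ z - w → x - z ≈ y - w
  x-y≈z-w⇒x-z≈y-w {x} {y} {z} {w} eq = x∙y⁻¹≈ε⇒x≈y (x - z) (y - w) (begin
    (x - z) - (y - w)       ≈⟨ +-congˡ (-‿+-comm y (- w)) ⟨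
    (x - z) + (- y - - w)   ≈⟨ interchange x (- z) (- y) (- - w) ⟩
    (x - y) + (- z - - w)   ≈⟨ +-congˡ (-‿+-comm z (- w)) ⟩
    (x - y) - (z - w)       ≈⟨ x≈y⇒x∙y⁻¹≈ε eq ⟩
    0#                      ∎)
    where open CommutativeSemigroupProperties +-commutativeSemigroup using (interchange)

  *-inverse-unique : ∀ {x y z} → x * y ≈ 1# → x * z ≈ 1# → y ≈ z
  *-inverse-unique {x} {y} {z} xy≈1 xz≈1 = begin
    y            ≈⟨ *-identityʳ y ⟨
    y * 1#       ≈⟨ *-congˡ xz≈1 ⟨
    y * (x * z)  ≈⟨ *-assoc y x z ⟨
    y * x * z    ≈⟨ *-congʳ (trans (*-comm y x) xy≈1) ⟩
    1# * z       ≈⟨ *-identityˡ z ⟩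
    z            ∎

module FiniteSum {c ℓ} (R : CommutativeRing c ℓ) where
  open CommutativeRing R
  open Series R using (Σ≤)
  open RingLemmas R using (-‿+-comm)
  open CommutativeSemigroupProperties +-commutativeSemigroup using (interchange)
  open SetoidReasoning setoid

  Σ≤-cong-≤ : ∀ n {f g : ℕ → Carrier} → (∀ m → m ≤ n → f m ≈ g m) → Σ≤ n f ≈ Σ≤ n g
  Σ≤-cong-≤ zero    f≈g = f≈g 0 z≤n
  Σ≤-cong-≤ (suc n) f≈g =
    +-cong (Σ≤-cong-≤ n (λ m m≤n → f≈g m (ℕ.m≤n⇒m≤1+n m≤n))) (f≈g (suc n) ℕ.≤-refl)

  Σ≤-cong : ∀ n {f g : ℕ → Carrier} → (∀ m → f m ≈ g m) → Σ≤ n f ≈ Σ≤ n g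
  Σ≤-cong n f≈g = Σ≤-cong-≤ n (λ m _ → f≈g m)

  Σ≤-zero : ∀ n {f : ℕ → Carrier} → (∀ m → m ≤ n → f m ≈ 0#) → Σ≤ n f ≈ 0#
  Σ≤-zero zero    f≈0 = f≈0 0 z≤n
  Σ≤-zero (suc n) f≈0 = trans
    (+-cong (Σ≤-zero n (λ m m≤n → f≈0 m (ℕ.m≤n⇒m≤1+n m≤n))) (f≈0 (suc n) ℕ.≤-refl))
    (+-identityˡ 0#)

  Σ≤-distrib-+ : ∀ n (f g : ℕ → Carrier) → Σ≤ n (λ m → f m + g m) ≈ Σ≤ n f + Σ≤ n g
  Σ≤-distrib-+ zero    f g = refl
  Σ≤-distrib-+ (suc n) f g = trans (+-congʳ (Σ≤-distrib-+ n f g)) (interchange _ _ _ _)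

  Σ≤-distrib-minus : ∀ n (f g : ℕ → Carrier) → Σ≤ n (λ m → f m - g m) ≈ Σ≤ n f - Σ≤ n g
  Σ≤-distrib-minus n f g = trans (Σ≤-distrib-+ n f (λ m → - g m)) (+-congˡ (Σ≤-neg n))
    where
    Σ≤-neg : ∀ n → Σ≤ n (λ m → - g m) ≈ - Σ≤ n g
    Σ≤-neg zero    = refl
    Σ≤-neg (suc n) = trans (+-congʳ (Σ≤-neg n)) (-‿+-comm (Σ≤ n g) (g (suc n)))

  *-distribˡ-Σ≤ : ∀ n x (f : ℕ → Carrier) → x * Σ≤ n f ≈ Σ≤ n (λ m → x * f m)
  *-distribˡ-Σ≤ zero    x f = refl
  *-distribˡ-Σ≤ (suc n) x f = trans (distribˡ x _ _) (+-congʳ (*-distribˡ-Σ≤ n x f))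

  *-distribʳ-Σ≤ : ∀ n x (f : ℕ → Carrier) → Σ≤ n f * x ≈ Σ≤ n (λ m → f m * x)
  *-distribʳ-Σ≤ zero    x f = refl
  *-distribʳ-Σ≤ (suc n) x f = trans (distribʳ x _ _) (+-congʳ (*-distribʳ-Σ≤ n x f))

  Σ≤-*-Σ≤ : ∀ m n (f g : ℕ → Carrier) → Σ≤ m f * Σ≤ n g ≈ Σ≤ m (λ i → Σ≤ n (λ j → f i * g j))
  Σ≤-*-Σ≤ m n f g = trans (*-distribʳ-Σ≤ m (Σ≤ n g) f) (Σ≤-cong m (λ i → *-distribˡ-Σ≤ n (f i) g))

  Σ≤-suc : ∀ n (f : ℕ → Carrier) → Σ≤ (suc n) f ≈ f 0 + Σ≤ n (λ m → f (suc m))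
  Σ≤-suc zero    f = refl
  Σ≤-suc (suc n) f = trans (+-congʳ (Σ≤-suc n f)) (+-assoc _ _ _)

  Σ≤-reverse : ∀ n (f : ℕ → Carrier) → Σ≤ n f ≈ Σ≤ n (λ m → f (n ∸ m))
  Σ≤-reverse zero    f = refl
  Σ≤-reverse (suc n) f = begin
    Σ≤ n f + f (suc n)                   ≈⟨ +-congʳ (Σ≤-reverse n f) ⟩
    Σ≤ n (λ m → f (n ∸ m)) + f (suc n)   ≈⟨ +-comm _ _ ⟩
    f (suc n) + Σ≤ n (λ m → f (n ∸ m))   ≈⟨ Σ≤-suc n (λ m → f (suc n ∸ m)) ⟨
    Σ≤ (suc n) (λ m → f (suc n ∸ m))     ∎

  Σ≤-comm : ∀ m n (F : ℕ → ℕ → Carrier) →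
            Σ≤ m (λ i → Σ≤ n (F i)) ≈ Σ≤ n (λ j → Σ≤ m (λ i → F i j))
  Σ≤-comm zero    n F = refl
  Σ≤-comm (suc m) n F =
    trans (+-congʳ (Σ≤-comm m n F)) (sym (Σ≤-distrib-+ n (λ j → Σ≤ m (λ i → F i j)) (F (suc m))))

  Σ≤-triangle : ∀ n (F : ℕ → ℕ → Carrier) →
    Σ≤ n (λ i → Σ≤ i (λ a → F a i)) ≈ Σ≤ n (λ a → Σ≤ (n ∸ a) (λ b → F a (a +ℕ b)))
  Σ≤-triangle zero    F = refl
  Σ≤-triangle (suc n) F = begin
    Σ≤ n (λ i → Σ≤ i (λ a → F a i)) + (Σ≤ n (λ a → F a (suc n)) + F (suc n) (suc n))
      ≈⟨ +-congʳ (Σ≤-triangle n F) ⟩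
    Σ≤ n row + (Σ≤ n (λ a → F a (suc n)) + F (suc n) (suc n))
      ≈⟨ +-assoc _ _ _ ⟨
    Σ≤ n row + Σ≤ n (λ a → F a (suc n)) + F (suc n) (suc n)
      ≈⟨ +-congʳ (Σ≤-distrib-+ n row (λ a → F a (suc n))) ⟨
    Σ≤ n (λ a → row a + F a (suc n)) + F (suc n) (suc n)
      ≈⟨ +-cong (Σ≤-cong-≤ n extend) corner ⟩
    Σ≤ (suc n) (λ a → Σ≤ (suc n ∸ a) (λ b → F a (a +ℕ b))) ∎
    where
    row : ℕ → Carrier
    row a = Σ≤ (n ∸ a) (λ b → F a (a +ℕ b))

    extend : ∀ a → a ≤ n → row a + F a (suc n) ≈ Σ≤ (suc n ∸ a) (λ b → F a (a +ℕ b))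
    extend a a≤n rewrite ℕ.+-∸-assoc 1 a≤n = +-congˡ (reflexive (≡.cong (F a) (≡.sym
      (≡.trans (ℕ.+-suc a (n ∸ a)) (≡.cong suc (ℕ.m+[n∸m]≡n a≤n))))))

    corner : F (suc n) (suc n) ≈ Σ≤ (n ∸ n) (λ b → F (suc n) (suc n +ℕ b))
    corner rewrite ℕ.n∸n≡0 n | ℕ.+-identityʳ n = refl

  Σ≤-truncate : ∀ {k m} (f : ℕ → Carrier) → k ≤ m → (∀ j → k < j → f j ≈ 0#) → Σ≤ m f ≈ Σ≤ k f
  Σ≤-truncate {k} f k≤m f≈0 = drop (ℕ.≤⇒≤′ k≤m)
    where
    drop : ∀ {m} → k ≤′ m → Σ≤ m f ≈ Σ≤ k f
    drop ≤′-refl        = refl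
    drop (≤′-step k≤′m) = trans (+-cong (drop k≤′m) (f≈0 _ (s≤s (ℕ.≤′⇒≤ k≤′m)))) (+-identityʳ _)

module CauchyProduct {c ℓ} (R : CommutativeRing c ℓ) where
  open CommutativeRing R
  open Series R using (Σ≤)
  open FiniteSum R
  open SetoidReasoning setoid

  Seq : Set c
  Seq = ℕ → Carrier

  _≈ₛ_ : Rel Seq ℓ
  f ≈ₛ g = ∀ n → f n ≈ g n

  _*ₛ_ : Seq → Seq → Seq
  (f *ₛ g) n = Σ≤ n (λ i → f i * g (n ∸ i))

  1ₛ : Seq
  1ₛ zero    = 1#
  1ₛ (suc n) = 0#

  *ₛ-cong : ∀ {f f′ g g′} → f ≈ₛ f′ → g ≈ₛ g′ → (f *ₛ g) ≈ₛ (f′ *ₛ g′)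
  *ₛ-cong f≈f′ g≈g′ n = Σ≤-cong n (λ i → *-cong (f≈f′ i) (g≈g′ (n ∸ i)))

  *ₛ-comm : ∀ f g → (f *ₛ g) ≈ₛ (g *ₛ f)
  *ₛ-comm f g n = begin
    Σ≤ n (λ i → f i * g (n ∸ i))              ≈⟨ Σ≤-reverse n _ ⟩
    Σ≤ n (λ i → f (n ∸ i) * g (n ∸ (n ∸ i)))  ≈⟨ Σ≤-cong-≤ n swap ⟩
    Σ≤ n (λ i → g i * f (n ∸ i))              ∎
    where
    swap : ∀ i → i ≤ n → f (n ∸ i) * g (n ∸ (n ∸ i)) ≈ g i * f (n ∸ i)
    swap i i≤n = trans (*-comm _ _) (*-congʳ (reflexive (≡.cong g (ℕ.m∸[m∸n]≡n i≤n))))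

  *ₛ-identityˡ : ∀ f → (1ₛ *ₛ f) ≈ₛ f
  *ₛ-identityˡ f zero    = *-identityˡ (f 0)
  *ₛ-identityˡ f (suc n) = begin
    Σ≤ (suc n) (λ i → 1ₛ i * f (suc n ∸ i))         ≈⟨ Σ≤-suc n _ ⟩
    1# * f (suc n) + Σ≤ n (λ i → 0# * f (n ∸ i))    ≈⟨ +-cong (*-identityˡ _) (Σ≤-zero n (λ i _ → zeroˡ _)) ⟩
    f (suc n) + 0#                                  ≈⟨ +-identityʳ _ ⟩
    f (suc n)                                       ∎

  *ₛ-distribʳ : ∀ h f g → ((λ n → f n + g n) *ₛ h) ≈ₛ (λ n → (f *ₛ h) n + (g *ₛ h) n)
  *ₛ-distribʳ h f g n = trans (Σ≤-cong n (λ i → distribʳ _ _ _)) (Σ≤-distrib-+ n _ _)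

  *ₛ-assoc : ∀ f g h → ((f *ₛ g) *ₛ h) ≈ₛ (f *ₛ (g *ₛ h))
  *ₛ-assoc f g h n = begin
    Σ≤ n (λ i → Σ≤ i (λ a → f a * g (i ∸ a)) * h (n ∸ i))
      ≈⟨ Σ≤-cong n (λ i → *-distribʳ-Σ≤ i _ _) ⟩
    Σ≤ n (λ i → Σ≤ i (λ a → f a * g (i ∸ a) * h (n ∸ i)))
      ≈⟨ Σ≤-triangle n _ ⟩
    Σ≤ n (λ a → Σ≤ (n ∸ a) (λ b → f a * g (a +ℕ b ∸ a) * h (n ∸ (a +ℕ b))))
      ≈⟨ Σ≤-cong n (λ a → Σ≤-cong (n ∸ a) (λ b → trans (*-assoc _ _ _) (*-congˡ (reindex a b)))) ⟩
    Σ≤ n (λ a → Σ≤ (n ∸ a) (λ b → f a * (g b * h (n ∸ a ∸ b))))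
      ≈⟨ Σ≤-cong n (λ a → *-distribˡ-Σ≤ (n ∸ a) _ _) ⟨
    Σ≤ n (λ a → f a * Σ≤ (n ∸ a) (λ b → g b * h (n ∸ a ∸ b))) ∎
    where
    reindex : ∀ a b → g (a +ℕ b ∸ a) * h (n ∸ (a +ℕ b)) ≈ g b * h (n ∸ a ∸ b)
    reindex a b = *-cong (reflexive (≡.cong g (ℕ.m+n∸m≡n a b)))
                         (reflexive (≡.cong h (≡.sym (ℕ.∸-+-assoc n a b))))

  cauchyRing : CommutativeRing c ℓ
  cauchyRing = record
    { Carrier = Seq
    ; _≈_ = _≈ₛ_
    ; _+_ = λ f g n → f n + g n
    ; _*_ = _*ₛ_
    ; -_ = λ f n → - f n
    ; 0# = λ _ → 0#
    ; 1# = 1ₛ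
    ; isCommutativeRing = record
      { isRing = record
        { +-isAbelianGroup = Pointwise.isAbelianGroup ℕ +-isAbelianGroup
        ; *-cong = *ₛ-cong
        ; *-assoc = *ₛ-assoc
        ; *-identity = *ₛ-identityˡ , λ f n → trans (*ₛ-comm f 1ₛ n) (*ₛ-identityˡ f n)
        ; distrib = (λ h f g n → trans (*ₛ-comm h _ n)
                                  (trans (*ₛ-distribʳ h f g n) (+-cong (*ₛ-comm f h n) (*ₛ-comm g h n))))
                  , *ₛ-distribʳ
        }
      ; *-comm = *ₛ-comm
      }
    }

  Σ≤-apply : ∀ n (F : ℕ → Seq) m → Series.Σ≤ cauchyRing n F m ≈ Σ≤ n (λ i → F i m)
  Σ≤-apply zero    F m = refl
  Σ≤-apply (suc n) F m = +-congʳ (Σ≤-apply n F m)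

module RingConstructions {c ℓ} (R : CommutativeRing c ℓ) where
  open CommutativeRing R
  open SetoidReasoning setoid

  withMultiplication : (_⊛_ : Op₂ Carrier) (e : Carrier) →
                       (∀ x y → (x ⊛ y) ≈ (x * y)) → e ≈ 1# → CommutativeRing c ℓ
  withMultiplication _⊛_ e ⊛≈* e≈1 = record
    { _≈_ = _≈_
    ; _+_ = _+_
    ; _*_ = _⊛_
    ; -_ = -_
    ; 0# = 0#
    ; 1# = e
    ; isCommutativeRing = record
      { isRing = record
        { +-isAbelianGroup = +-isAbelianGroup
        ; *-cong = λ {x} {x′} {y} {y′} x≈x′ y≈y′ →
            trans (⊛≈* x y) (trans (*-cong x≈x′ y≈y′) (sym (⊛≈* x′ y′)))
        ; *-assoc = λ x y z → begin
            (x ⊛ y) ⊛ z  ≈⟨ trans (⊛≈* _ z) (*-congʳ (⊛≈* x y)) ⟩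
            x * y * z    ≈⟨ *-assoc x y z ⟩
            x * (y * z)  ≈⟨ trans (⊛≈* x _) (*-congˡ (⊛≈* y z)) ⟨
            x ⊛ (y ⊛ z)  ∎
        ; *-identity = (λ x → trans (⊛≈* e x) (trans (*-congʳ e≈1) (*-identityˡ x)))
                     , (λ x → trans (⊛≈* x e) (trans (*-congˡ e≈1) (*-identityʳ x)))
        ; distrib = (λ x y z → trans (⊛≈* x _) (trans (distribˡ x y z) (sym (+-cong (⊛≈* x y) (⊛≈* x z)))))
                  , (λ x y z → trans (⊛≈* _ x) (trans (distribʳ x y z) (sym (+-cong (⊛≈* y x) (⊛≈* z x)))))
        }
      ; *-comm = λ x y → trans (⊛≈* x y) (trans (*-comm x y) (sym (⊛≈* y x)))
      }
    }

  coarsen : ∀ {ℓ′} {_∼_ : Rel Carrier ℓ′} → IsEquivalence _∼_ → _≈_ ⇒ _∼_ →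
            Congruent₂ _∼_ _+_ → Congruent₂ _∼_ _*_ → Congruent₁ _∼_ (-_) → CommutativeRing c ℓ′
  coarsen {_∼_ = _∼_} isEquivalence ≈⇒∼ +-cong∼ *-cong∼ -‿cong∼ = record
    { _≈_ = _∼_
    ; _+_ = _+_
    ; _*_ = _*_
    ; -_ = -_
    ; 0# = 0#
    ; 1# = 1#
    ; isCommutativeRing = record
      { isRing = record
        { +-isAbelianGroup = record
          { isGroup = record
            { isMonoid = record
              { isSemigroup = record
                { isMagma = record { isEquivalence = isEquivalence ; ∙-cong = +-cong∼ }
                ; assoc = λ x y z → ≈⇒∼ (+-assoc x y z) }
              ; identity = (λ x → ≈⇒∼ (+-identityˡ x)) , (λ x → ≈⇒∼ (+-identityʳ x)) }
            ; inverse = (λ x → ≈⇒∼ (-‿inverseˡ x)) , (λ x → ≈⇒∼ (-‿inverseʳ x))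
            ; ⁻¹-cong = -‿cong∼ }
          ; comm = λ x y → ≈⇒∼ (+-comm x y) }
        ; *-cong = *-cong∼
        ; *-assoc = λ x y z → ≈⇒∼ (*-assoc x y z)
        ; *-identity = (λ x → ≈⇒∼ (*-identityˡ x)) , (λ x → ≈⇒∼ (*-identityʳ x))
        ; distrib = (λ x y z → ≈⇒∼ (distribˡ x y z)) , (λ x y z → ≈⇒∼ (distribʳ x y z)) }
      ; *-comm = λ x y → ≈⇒∼ (*-comm x y) } }

module PowerSeriesRing {c ℓ} (R : CommutativeRing c ℓ) where
  open CommutativeRing R
  open Series R renaming (_≋_ to infix 4 _≋_)

  private
    module C¹ = CauchyProduct R
    module C² = CauchyProduct C¹.cauchyRing
    module C³ = CauchyProduct C².cauchyRing
    module C⁴ = CauchyProduct C³.cauchyRing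
    module Σ⁰ = FiniteSum R
    module Σ¹ = FiniteSum C¹.cauchyRing
    module R¹ = CommutativeRing C¹.cauchyRing

    peel : ∀ {x y} → x ≈ y → 1# * x ≈ y
    peel x≈y = trans (*-identityˡ _) x≈y

  ⊗≋iterated-product : ∀ f g → (f ⊗ g) ≋ C⁴._*ₛ_ f g
  ⊗≋iterated-product f g i j k l = sym
    (trans (C³.Σ≤-apply i _ j k l)
    (trans (R¹.trans (C².Σ≤-apply i _ k) (Σ¹.Σ≤-cong i (λ _ → C².Σ≤-apply j _ k)) l)
    (trans (C¹.Σ≤-apply i _ l)
           (Σ⁰.Σ≤-cong i (λ _ → trans (C¹.Σ≤-apply j _ l) (Σ⁰.Σ≤-cong j (λ _ → C¹.Σ≤-apply k _ l)))))))

  𝟙≋iterated-one : 𝟙 ≋ C⁴.1ₛ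
  𝟙≋iterated-one zero    zero    zero    zero    = peel (peel (peel (peel refl)))
  𝟙≋iterated-one zero    zero    zero    (suc l) = peel (peel (peel (peel refl)))
  𝟙≋iterated-one zero    zero    (suc k) l       = peel (peel (peel (zeroˡ _)))
  𝟙≋iterated-one zero    (suc j) k       l       = peel (peel (zeroˡ _))
  𝟙≋iterated-one (suc i) j       k       l       = peel (zeroˡ _)

  powerSeriesRing : CommutativeRing c ℓ
  powerSeriesRing =
    RingConstructions.withMultiplication C⁴.cauchyRing _⊗_ 𝟙 ⊗≋iterated-product 𝟙≋iterated-one

  module P = CommutativeRing powerSeriesRing
  module PL = RingLemmas powerSeriesRing

  𝟘 : PS
  𝟘 _ _ _ _ = 0#

  ⊗-coeff-cong : ∀ {f g f′ g′} i j k l →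
    (∀ i₁ j₁ k₁ l₁ → i₁ ≤ i → j₁ ≤ j → k₁ ≤ k → l₁ ≤ l →
       f i₁ j₁ k₁ l₁ * g (i ∸ i₁) (j ∸ j₁) (k ∸ k₁) (l ∸ l₁) ≈
       f′ i₁ j₁ k₁ l₁ * g′ (i ∸ i₁) (j ∸ j₁) (k ∸ k₁) (l ∸ l₁)) →
    (f ⊗ g) i j k l ≈ (f′ ⊗ g′) i j k l
  ⊗-coeff-cong i j k l eq =
    Σ⁰.Σ≤-cong-≤ i λ _ i₁≤i → Σ⁰.Σ≤-cong-≤ j λ _ j₁≤j → Σ⁰.Σ≤-cong-≤ k λ _ k₁≤k →
    Σ⁰.Σ≤-cong-≤ l λ _ l₁≤l → eq _ _ _ _ i₁≤i j₁≤j k₁≤k l₁≤l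

  ⊗-coeff-zero : ∀ {f g} i j k l →
    (∀ i₁ j₁ k₁ l₁ → i₁ ≤ i → j₁ ≤ j → k₁ ≤ k → l₁ ≤ l →
       f i₁ j₁ k₁ l₁ * g (i ∸ i₁) (j ∸ j₁) (k ∸ k₁) (l ∸ l₁) ≈ 0#) →
    (f ⊗ g) i j k l ≈ 0#
  ⊗-coeff-zero i j k l eq =
    Σ⁰.Σ≤-zero i λ _ i₁≤i → Σ⁰.Σ≤-zero j λ _ j₁≤j → Σ⁰.Σ≤-zero k λ _ k₁≤k →
    Σ⁰.Σ≤-zero l λ _ l₁≤l → eq _ _ _ _ i₁≤i j₁≤j k₁≤k l₁≤l

module Truncation {c ℓ} (R : CommutativeRing c ℓ) where
  open CommutativeRing R
  open Series R renaming (_≋_ to infix 4 _≋_)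
  open PowerSeriesRing R

  Weight : Set
  Weight = ℕ → ℕ → ℕ → ℕ → ℕ

  module Weighted (w : Weight)
    (w-additive : ∀ {i j k l i₁ j₁ k₁ l₁} → i₁ ≤ i → j₁ ≤ j → k₁ ≤ k → l₁ ≤ l →
                  w i₁ j₁ k₁ l₁ +ℕ w (i ∸ i₁) (j ∸ j₁) (k ∸ k₁) (l ∸ l₁) ≡ w i j k l) where

    infix 4 _≈[_]_
    _≈[_]_ : PS → ℕ → PS → Set ℓ
    f ≈[ N ] g = ∀ i j k l → w i j k l < N → f i j k l ≈ g i j k l

    Ord≥ : ℕ → PS → Set ℓ
    Ord≥ n f = f ≈[ n ] 𝟘

    ≋⇒≈[] : ∀ {N f g} → f ≋ g → f ≈[ N ] g
    ≋⇒≈[] f≋g i j k l _ = f≋g i j k l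

    ≈[]-all⇒≋ : ∀ {f g} → (∀ N → f ≈[ N ] g) → f ≋ g
    ≈[]-all⇒≋ f≈g i j k l = f≈g (suc (w i j k l)) i j k l ℕ.≤-refl

    ≈[]-isEquivalence : ∀ N → IsEquivalence (_≈[ N ]_)
    ≈[]-isEquivalence N = record
      { refl  = λ _ _ _ _ _ → refl
      ; sym   = λ f≈g i j k l w<N → sym (f≈g i j k l w<N)
      ; trans = λ f≈g g≈h i j k l w<N → trans (f≈g i j k l w<N) (g≈h i j k l w<N)
      }

    ≈[]-⊗ : ∀ {N f f′ g g′} → f ≈[ N ] f′ → g ≈[ N ] g′ → (f ⊗ g) ≈[ N ] (f′ ⊗ g′)
    ≈[]-⊗ {f = f} {f′} {g} {g′} f≈f′ g≈g′ i j k l w<N =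
      ⊗-coeff-cong {f} {g} {f′} {g′} i j k l λ i₁ j₁ k₁ l₁ i₁≤i j₁≤j k₁≤k l₁≤l →
        let w₁ = w i₁ j₁ k₁ l₁
            w₂ = w (i ∸ i₁) (j ∸ j₁) (k ∸ k₁) (l ∸ l₁)
            w₁+w₂≡w = w-additive i₁≤i j₁≤j k₁≤k l₁≤l
        in *-cong (f≈f′ _ _ _ _ (ℕ.≤-<-trans (≡.subst (w₁ ≤_) w₁+w₂≡w (ℕ.m≤m+n w₁ w₂)) w<N))
                  (g≈g′ _ _ _ _ (ℕ.≤-<-trans (≡.subst (w₂ ≤_) w₁+w₂≡w (ℕ.m≤n+m w₂ w₁)) w<N))

    truncRing : ℕ → CommutativeRing c ℓ
    truncRing N = RingConstructions.coarsen powerSeriesRing (≈[]-isEquivalence N) ≋⇒≈[]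
      (λ f≈f′ g≈g′ i j k l w<N → +-cong (f≈f′ i j k l w<N) (g≈g′ i j k l w<N))
      ≈[]-⊗
      (λ f≈f′ i j k l w<N → -‿cong (f≈f′ i j k l w<N))

    Ord≥-⊗ : ∀ {m n f g} → Ord≥ m f → Ord≥ n g → Ord≥ (m +ℕ n) (f ⊗ g)
    Ord≥-⊗ {m} {n} {f} {g} f≈0 g≈0 i j k l w<m+n = ⊗-coeff-zero {f} {g} i j k l term≈0
      where
      term≈0 : ∀ i₁ j₁ k₁ l₁ → i₁ ≤ i → j₁ ≤ j → k₁ ≤ k → l₁ ≤ l → _
      term≈0 i₁ j₁ k₁ l₁ i₁≤i j₁≤j k₁≤k l₁≤l with w i₁ j₁ k₁ l₁ <? m
      ... | yes w₁<m = trans (*-congʳ (f≈0 _ _ _ _ w₁<m)) (zeroˡ _)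
      ... | no  w₁≮m = trans (*-congˡ (g≈0 _ _ _ _ w₂<n)) (zeroʳ _)
        where
        w₂<n = ℕ.+-cancelˡ-< m _ n (ℕ.≤-<-trans (ℕ.+-monoˡ-≤ _ (ℕ.≮⇒≥ w₁≮m))
                 (≡.subst (_< m +ℕ n) (≡.sym (w-additive i₁≤i j₁≤j k₁≤k l₁≤l)) w<m+n))

    Ord≥-⊗ˡ : ∀ {m f} g → Ord≥ m f → Ord≥ m (f ⊗ g)
    Ord≥-⊗ˡ {m} {f} g f≈0 i j k l w<m =
      Ord≥-⊗ {m} {0} {f} {g} f≈0 (λ _ _ _ _ ()) i j k l (≡.subst (_ <_) (≡.sym (ℕ.+-identityʳ m)) w<m)

    Ord≥-⊗ʳ : ∀ {m g} f → Ord≥ m g → Ord≥ m (f ⊗ g)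
    Ord≥-⊗ʳ {m} {g} f g≈0 = Ord≥-⊗ {0} {m} {f} {g} (λ _ _ _ _ ()) g≈0

    Ord≥-weaken : ∀ {m n f} → n ≤ m → Ord≥ m f → Ord≥ n f
    Ord≥-weaken n≤m f≈0 i j k l w<n = f≈0 i j k l (ℕ.<-≤-trans w<n n≤m)

    Ord≥-^ᵖ : ∀ {x} n → Ord≥ 1 x → Ord≥ n (x ^ᵖ n)
    Ord≥-^ᵖ zero    x≈0 = λ _ _ _ _ ()
    Ord≥-^ᵖ {x} (suc n) x≈0 = Ord≥-⊗ {1} {n} {x} {x ^ᵖ n} x≈0 (Ord≥-^ᵖ n x≈0)

  -- Σ∞ is defined by truncation in total degree, pochInf by truncation in q-degree.
  totalDegree : Weight
  totalDegree i j k l = i +ℕ j +ℕ k +ℕ l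

  qDegree : Weight
  qDegree i _ _ _ = i

  totalDegree-additive : ∀ {i j k l i₁ j₁ k₁ l₁} → i₁ ≤ i → j₁ ≤ j → k₁ ≤ k → l₁ ≤ l →
    totalDegree i₁ j₁ k₁ l₁ +ℕ totalDegree (i ∸ i₁) (j ∸ j₁) (k ∸ k₁) (l ∸ l₁) ≡ totalDegree i j k l
  totalDegree-additive {i} {j} {k} {l} {i₁} {j₁} {k₁} {l₁} i₁≤i j₁≤j k₁≤k l₁≤l =
    ≡.trans (regroup i₁ (i ∸ i₁) j₁ (j ∸ j₁) k₁ (k ∸ k₁) l₁ (l ∸ l₁))
      (≡.cong₂ _+ℕ_ (≡.cong₂ _+ℕ_ (≡.cong₂ _+ℕ_ (ℕ.m+[n∸m]≡n i₁≤i) (ℕ.m+[n∸m]≡n j₁≤j))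
                                  (ℕ.m+[n∸m]≡n k₁≤k))
                    (ℕ.m+[n∸m]≡n l₁≤l))
    where
    regroup : ∀ a a′ b b′ c c′ d d′ →
      (a +ℕ b +ℕ c +ℕ d) +ℕ (a′ +ℕ b′ +ℕ c′ +ℕ d′) ≡ (a +ℕ a′) +ℕ (b +ℕ b′) +ℕ (c +ℕ c′) +ℕ (d +ℕ d′)
    regroup = solve-∀

  module T = Weighted totalDegree totalDegree-additive
  module Q = Weighted qDegree (λ i₁≤i _ _ _ → ℕ.m+[n∸m]≡n i₁≤i)

  Ord≥1-intro : ∀ {f} → f 0 0 0 0 ≈ 0# → T.Ord≥ 1 f
  Ord≥1-intro f₀≈0 zero    zero    zero    zero    _ = f₀≈0
  Ord≥1-intro f₀≈0 zero    zero    zero    (suc l) (s≤s ())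
  Ord≥1-intro f₀≈0 zero    zero    (suc k) l       (s≤s ())
  Ord≥1-intro f₀≈0 zero    (suc j) k       l       (s≤s ())
  Ord≥1-intro f₀≈0 (suc i) j       k       l       (s≤s ())

  mono-Ord≥1 : ∀ r e₁ e₂ e₃ e₄ → 0 < e₁ +ℕ e₂ +ℕ e₃ +ℕ e₄ → T.Ord≥ 1 (mono r e₁ e₂ e₃ e₄)
  mono-Ord≥1 r e₁ e₂ e₃ e₄ 0<e = Ord≥1-intro (x*0 (δ₀≈0 e₁ e₂ e₃ e₄ 0<e))
    where
    x*0 : ∀ {x y} → y ≈ 0# → x * y ≈ 0#
    x*0 {x} y≈0 = trans (*-congˡ y≈0) (zeroʳ x)

    δ₀≈0 : ∀ e₁ e₂ e₃ e₄ → 0 < e₁ +ℕ e₂ +ℕ e₃ +ℕ e₄ → δ e₁ 0 * (δ e₂ 0 * (δ e₃ 0 * δ e₄ 0)) ≈ 0#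
    δ₀≈0 (suc _) _       _       _       _ = zeroˡ _
    δ₀≈0 zero    (suc _) _       _       _ = x*0 (zeroˡ _)
    δ₀≈0 zero    zero    (suc _) _       _ = x*0 (x*0 (zeroˡ _))
    δ₀≈0 zero    zero    zero    (suc _) _ = x*0 (x*0 (zeroʳ _))

  𝐪-Ord≥1 : T.Ord≥ 1 𝐪
  𝐪-Ord≥1 = mono-Ord≥1 1# 1 0 0 0 (s≤s z≤n)

  𝐪-qOrd≥1 : Q.Ord≥ 1 𝐪
  𝐪-qOrd≥1 zero    j k l _       = trans (*-identityˡ _) (zeroˡ _)
  𝐪-qOrd≥1 (suc i) j k l (s≤s ())

  Q⇒T : ∀ {N f g} → f Q.≈[ N ] g → f T.≈[ N ] g
  Q⇒T {N} f≈g i j k l d<N = f≈g i j k l (ℕ.≤-<-trans i≤d d<N)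
    where
    i≤d = ℕ.≤-trans (ℕ.m≤m+n i j) (ℕ.≤-trans (ℕ.m≤m+n (i +ℕ j) k) (ℕ.m≤m+n (i +ℕ j +ℕ k) l))

module SeriesSums {c ℓ} (R : CommutativeRing c ℓ) where
  open CommutativeRing R
  open Series R renaming (_≋_ to infix 4 _≋_)
  open PowerSeriesRing R
  open Truncation R
  private
    module Σ⁰ = FiniteSum R

  ΣP≤-coeff : ∀ n (s : ℕ → PS) i j k l → ΣP≤ n s i j k l ≈ Σ≤ n (λ m → s m i j k l)
  ΣP≤-coeff zero    s i j k l = refl
  ΣP≤-coeff (suc n) s i j k l = +-congʳ (ΣP≤-coeff n s i j k l)

  ΣP≤-cong : ∀ n {s t : ℕ → PS} → (∀ m → s m ≋ t m) → ΣP≤ n s ≋ ΣP≤ n t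
  ΣP≤-cong zero    s≋t = s≋t 0
  ΣP≤-cong (suc n) s≋t = P.+-cong (ΣP≤-cong n s≋t) (s≋t (suc n))

  *-distribʳ-ΣP≤ : ∀ n x (s : ℕ → PS) → ΣP≤ n s ⊗ x ≋ ΣP≤ n (λ m → s m ⊗ x)
  *-distribʳ-ΣP≤ zero    x s = P.refl
  *-distribʳ-ΣP≤ (suc n) x s = P.trans (P.distribʳ x (ΣP≤ n s) (s (suc n))) (P.+-congʳ (*-distribʳ-ΣP≤ n x s))

  ΣP≤≈[]Σ≤ : ∀ N n (s : ℕ → PS) → ΣP≤ n s T.≈[ N ] Series.Σ≤ (T.truncRing N) n s
  ΣP≤≈[]Σ≤ N zero    s = CommutativeRing.refl (T.truncRing N)
  ΣP≤≈[]Σ≤ N (suc n) s = CommutativeRing.+-congʳ (T.truncRing N) (ΣP≤≈[]Σ≤ N n s)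

  ΣP≤-Ord≥ : ∀ {n} m (s : ℕ → PS) → (∀ k → k ≤ m → T.Ord≥ n (s k)) → T.Ord≥ n (ΣP≤ m s)
  ΣP≤-Ord≥ m s s≈0 i j k l d<n =
    trans (ΣP≤-coeff m s i j k l) (Σ⁰.Σ≤-zero m (λ k′ k′≤m → s≈0 k′ k′≤m i j k l d<n))

  Summable : (ℕ → PS) → Set ℓ
  Summable s = ∀ n → T.Ord≥ n (s n)

  Σ∞-truncate : ∀ {s} → Summable s → ∀ {N M} → N ≤ suc M → Σ∞ s T.≈[ N ] ΣP≤ M s
  Σ∞-truncate {s} summable {N} {M} N≤1+M i j k l d<N = begin
    ΣP≤ d s i j k l            ≈⟨ ΣP≤-coeff d s i j k l ⟩
    Σ≤ d (λ m → s m i j k l)   ≈⟨ Σ⁰.Σ≤-truncate _ d≤M (λ m d<m → summable m i j k l d<m) ⟨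
    Σ≤ M (λ m → s m i j k l)   ≈⟨ ΣP≤-coeff M s i j k l ⟨
    ΣP≤ M s i j k l            ∎
    where
    open SetoidReasoning setoid
    d = totalDegree i j k l
    d≤M = ℕ.≤-pred (ℕ.≤-trans d<N N≤1+M)

  Σ∞-head : ∀ {s N} → (∀ n → T.Ord≥ N (s (suc n))) → Σ∞ s T.≈[ N ] s 0
  Σ∞-head {s} tail≈0 i j k l d<N = trans (ΣP≤-coeff (totalDegree i j k l) s i j k l)
    (Σ⁰.Σ≤-truncate {m = totalDegree i j k l} (λ m → s m i j k l) z≤n λ { (suc m) _ → tail≈0 m i j k l d<N })

  Σ∞-cong : ∀ {s t} → (∀ n → s n ≋ t n) → Σ∞ s ≋ Σ∞ t
  Σ∞-cong s≋t i j k l = ΣP≤-cong (totalDegree i j k l) s≋t i j k l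

  Σ-triangle≈Σ-square : ∀ N (F : ℕ → ℕ → PS) → (∀ k j → T.Ord≥ (k +ℕ j) (F k (k +ℕ j))) →
    let Σ = Series.Σ≤ (T.truncRing N) in
    Σ N (λ m → Σ m (λ k → F k m)) T.≈[ N ] Σ N (λ k → Σ N (λ j → F k (k +ℕ j)))
  Σ-triangle≈Σ-square N F F≈0 = TN.trans (ΣN.Σ≤-triangle N F) (ΣN.Σ≤-cong-≤ N λ k k≤N →
    TN.sym (ΣN.Σ≤-truncate (λ j → F k (k +ℕ j)) (ℕ.m∸n≤m N k) λ j N∸k<j →
      T.Ord≥-weaken (N≤k+j k≤N N∸k<j) (F≈0 k j)))
    where
    module TN = CommutativeRing (T.truncRing N)
    module ΣN = FiniteSum (T.truncRing N)
    N≤k+j : ∀ {k j} → k ≤ N → N ∸ k < j → N ≤ k +ℕ j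
    N≤k+j {k} k≤N N∸k<j = ℕ.≤-trans (ℕ.≤-reflexive (≡.sym (ℕ.m+[n∸m]≡n k≤N))) (ℕ.+-monoʳ-≤ k (ℕ.<⇒≤ N∸k<j))

module Pochhammer {c ℓ} (R : CommutativeRing c ℓ) where
  open CommutativeRing R
  open Series R renaming (_≋_ to infix 4 _≋_)
  open PowerSeriesRing R
  open Truncation R
  open ExpProperties P.commutativeSemiring using (_^_; ^-congˡ; ^-homo-*; ^-assocʳ; ^-distrib-*)

  ^ᵖ≋^ : ∀ x n → x ^ᵖ n ≋ x ^ n
  ^ᵖ≋^ x zero    = P.refl
  ^ᵖ≋^ x (suc n) = P.*-congˡ (^ᵖ≋^ x n)

  ^ᵖ-cong : ∀ {x y} n → x ≋ y → x ^ᵖ n ≋ y ^ᵖ n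
  ^ᵖ-cong {x} {y} n x≋y = P.trans (^ᵖ≋^ x n) (P.trans (^-congˡ n x≋y) (P.sym (^ᵖ≋^ y n)))

  ^ᵖ-homo-⊗ : ∀ x m n → x ^ᵖ (m +ℕ n) ≋ x ^ᵖ m ⊗ x ^ᵖ n
  ^ᵖ-homo-⊗ x m n = P.trans (^ᵖ≋^ x (m +ℕ n))
    (P.trans (^-homo-* x m n) (P.sym (P.*-cong (^ᵖ≋^ x m) (^ᵖ≋^ x n))))

  ^ᵖ-distrib-⊗ : ∀ x y n → (x ⊗ y) ^ᵖ n ≋ x ^ᵖ n ⊗ y ^ᵖ n
  ^ᵖ-distrib-⊗ x y n = P.trans (^ᵖ≋^ (x ⊗ y) n)
    (P.trans (^-distrib-* x y n) (P.sym (P.*-cong (^ᵖ≋^ x n) (^ᵖ≋^ y n))))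

  ^ᵖ-assocʳ : ∀ x m n → (x ^ᵖ m) ^ᵖ n ≋ x ^ᵖ (m *ℕ n)
  ^ᵖ-assocʳ x m n = P.trans (^ᵖ≋^ (x ^ᵖ m) n)
    (P.trans (^-congˡ n (^ᵖ≋^ x m)) (P.trans (^-assocʳ x m n) (P.sym (^ᵖ≋^ x (m *ℕ n)))))

  ⊗𝐪^-qOrd≥ : ∀ x n → Q.Ord≥ n (x ⊗ 𝐪 ^ᵖ n)
  ⊗𝐪^-qOrd≥ x n = Q.Ord≥-⊗ʳ {n} {𝐪 ^ᵖ n} x (Q.Ord≥-^ᵖ n 𝐪-qOrd≥1)

  ⊗𝐪^-Ord≥ : ∀ x n → T.Ord≥ n (x ⊗ 𝐪 ^ᵖ n)
  ⊗𝐪^-Ord≥ x n = Q⇒T {n} {x ⊗ 𝐪 ^ᵖ n} (⊗𝐪^-qOrd≥ x n)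

  poch-cong : ∀ {x y} n → x ≋ y → poch x n ≋ poch y n
  poch-cong zero    x≋y = P.refl
  poch-cong (suc n) x≋y = P.*-cong (poch-cong n x≋y) (P.+-congˡ {𝟙} (P.-‿cong (P.*-congʳ {𝐪 ^ᵖ n} x≋y)))

  pochInf-cong : ∀ {x y} → x ≋ y → pochInf x ≋ pochInf y
  pochInf-cong x≋y i j k l = poch-cong (suc i) x≋y i j k l

  poch-+ : ∀ x n m → poch x (n +ℕ m) ≋ poch x n ⊗ poch (x ⊗ 𝐪 ^ᵖ n) m
  poch-+ x n zero    rewrite ℕ.+-identityʳ n = P.sym (P.*-identityʳ (poch x n))
  poch-+ x n (suc m) rewrite ℕ.+-suc n m = begin
    poch x (n +ℕ m) ⊗ (𝟙 ⊖ x ⊗ 𝐪 ^ᵖ (n +ℕ m))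
      ≈⟨ P.*-cong (poch-+ x n m) (P.+-congˡ {𝟙} (P.-‿cong shift)) ⟩
    (poch x n ⊗ poch (x ⊗ 𝐪 ^ᵖ n) m) ⊗ (𝟙 ⊖ (x ⊗ 𝐪 ^ᵖ n) ⊗ 𝐪 ^ᵖ m)
      ≈⟨ P.*-assoc (poch x n) (poch (x ⊗ 𝐪 ^ᵖ n) m) (𝟙 ⊖ (x ⊗ 𝐪 ^ᵖ n) ⊗ 𝐪 ^ᵖ m) ⟩
    poch x n ⊗ (poch (x ⊗ 𝐪 ^ᵖ n) m ⊗ (𝟙 ⊖ (x ⊗ 𝐪 ^ᵖ n) ⊗ 𝐪 ^ᵖ m)) ∎
    where
    open SetoidReasoning P.setoid
    shift : x ⊗ 𝐪 ^ᵖ (n +ℕ m) ≋ (x ⊗ 𝐪 ^ᵖ n) ⊗ 𝐪 ^ᵖ m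
    shift = P.trans (P.*-congˡ (^ᵖ-homo-⊗ 𝐪 n m)) (P.sym (P.*-assoc x (𝐪 ^ᵖ n) (𝐪 ^ᵖ m)))

  poch-𝟘 : ∀ {y} n → y ≋ 𝟘 → poch y n ≋ 𝟙
  poch-𝟘 zero    y≋0 = P.refl
  poch-𝟘 {y} (suc n) y≋0 = begin
    poch y n ⊗ (𝟙 ⊖ y ⊗ 𝐪 ^ᵖ n)
      ≈⟨ P.*-cong (poch-𝟘 n y≋0) (P.+-congˡ {𝟙} (P.-‿cong (P.trans (P.*-congʳ {𝐪 ^ᵖ n} y≋0) (P.zeroˡ (𝐪 ^ᵖ n))))) ⟩
    𝟙 ⊗ (𝟙 ⊖ 𝟘)  ≈⟨ P.*-identityˡ (𝟙 ⊖ 𝟘) ⟩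
    𝟙 ⊖ 𝟘        ≈⟨ PL.x-0≈x 𝟙 ⟩
    𝟙            ∎
    where open SetoidReasoning P.setoid

  pochInf-𝟘 : ∀ {y} → y ≋ 𝟘 → pochInf y ≋ 𝟙
  pochInf-𝟘 y≋0 i j k l = poch-𝟘 (suc i) y≋0 i j k l

  poch-stable : ∀ x {N M} → N ≤ M → poch x M Q.≈[ N ] poch x N
  poch-stable x {N} N≤M = go (ℕ.≤⇒≤′ N≤M)
    where
    module QN = CommutativeRing (Q.truncRing N)
    module QL = RingLemmas (Q.truncRing N)
    open SetoidReasoning QN.setoid

    go : ∀ {M} → N ≤′ M → poch x M Q.≈[ N ] poch x N
    go ≤′-refl = QN.refl
    go {suc M} (≤′-step N≤′M) = begin
      poch x M ⊗ (𝟙 ⊖ x ⊗ 𝐪 ^ᵖ M)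
        ≈⟨ QN.*-congˡ (QN.+-congˡ {𝟙} (QN.-‿cong (Q.Ord≥-weaken (ℕ.≤′⇒≤ N≤′M) (⊗𝐪^-qOrd≥ x M)))) ⟩
      poch x M ⊗ (𝟙 ⊖ 𝟘)  ≈⟨ QN.*-congˡ (QL.x-0≈x 𝟙) ⟩
      poch x M ⊗ 𝟙        ≈⟨ QN.*-identityʳ (poch x M) ⟩
      poch x M            ≈⟨ go N≤′M ⟩
      poch x N            ∎

  pochInf≈[]poch : ∀ x {N M} → N ≤ M → pochInf x Q.≈[ N ] poch x M
  pochInf≈[]poch x N≤M i j k l i<N = sym (poch-stable x (ℕ.≤-trans i<N N≤M) i j k l ℕ.≤-refl)

  pochInf-split : ∀ x n → pochInf x ≋ poch x n ⊗ pochInf (x ⊗ 𝐪 ^ᵖ n)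
  pochInf-split x n = Q.≈[]-all⇒≋ λ N →
    let module QN = CommutativeRing (Q.truncRing N)
        open SetoidReasoning QN.setoid
    in begin
    pochInf x                        ≈⟨ pochInf≈[]poch x (ℕ.m≤n+m N n) ⟩
    poch x (n +ℕ N)                  ≈⟨ Q.≋⇒≈[] (poch-+ x n N) ⟩
    poch x n ⊗ poch (x ⊗ 𝐪 ^ᵖ n) N   ≈⟨ QN.*-congˡ {poch x n} (pochInf≈[]poch (x ⊗ 𝐪 ^ᵖ n) ℕ.≤-refl) ⟨
    poch x n ⊗ pochInf (x ⊗ 𝐪 ^ᵖ n)  ∎

module Inverses {c ℓ} (R : CommutativeRing c ℓ) where
  open CommutativeRing R
  open Series R renaming (_≋_ to infix 4 _≋_)
  open PowerSeriesRing R
  open Truncation R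
  open SeriesSums R
  open Pochhammer R

  ConstantTermOne : PS → Set ℓ
  ConstantTermOne f = f T.≈[ 1 ] 𝟙

  private
    module T₁ = CommutativeRing (T.truncRing 1)
    module T₁L = RingLemmas (T.truncRing 1)

  ConstantTermOne-⊗ : ∀ {f g} → ConstantTermOne f → ConstantTermOne g → ConstantTermOne (f ⊗ g)
  ConstantTermOne-⊗ f≈1 g≈1 = T₁.trans (T₁.*-cong f≈1 g≈1) (T₁.*-identityˡ 𝟙)

  ConstantTermOne-poch : ∀ {x} → T.Ord≥ 1 x → ∀ n → ConstantTermOne (poch x n)
  ConstantTermOne-poch x≈0 zero    = T₁.refl
  ConstantTermOne-poch {x} x≈0 (suc n) = ConstantTermOne-⊗ (ConstantTermOne-poch x≈0 n)
    (T₁.trans (T₁.+-congˡ (T₁.-‿cong (T.Ord≥-⊗ˡ {1} {x} (𝐪 ^ᵖ n) x≈0))) (T₁L.x-0≈x 𝟙))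

  ConstantTermOne-pochInf : ∀ {x} → T.Ord≥ 1 x → ConstantTermOne (pochInf x)
  ConstantTermOne-pochInf {x} x≈0 =
    T₁.trans (Q⇒T {1} {pochInf x} (pochInf≈[]poch x ℕ.≤-refl)) (ConstantTermOne-poch x≈0 1)

  geometric-sum : ∀ g M → (𝟙 ⊖ g) ⊗ ΣP≤ M (g ^ᵖ_) ≋ 𝟙 ⊖ g ^ᵖ suc M
  geometric-sum g zero    = P.trans (P.*-identityʳ (𝟙 ⊖ g)) (P.+-congˡ (P.-‿cong (P.sym (P.*-identityʳ g))))
  geometric-sum g (suc M) = begin
    (𝟙 ⊖ g) ⊗ (ΣP≤ M (g ^ᵖ_) ⊕ g ^ᵖ suc M)
      ≈⟨ P.distribˡ (𝟙 ⊖ g) (ΣP≤ M (g ^ᵖ_)) (g ^ᵖ suc M) ⟩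
    (𝟙 ⊖ g) ⊗ ΣP≤ M (g ^ᵖ_) ⊕ (𝟙 ⊖ g) ⊗ g ^ᵖ suc M
      ≈⟨ P.+-cong (geometric-sum g M) (PL.[1-x]y≈y-xy g (g ^ᵖ suc M)) ⟩
    (𝟙 ⊖ g ^ᵖ suc M) ⊕ (g ^ᵖ suc M ⊖ g ^ᵖ suc (suc M))
      ≈⟨ PL.[x-y]+[y-z]≈x-z 𝟙 (g ^ᵖ suc M) (g ^ᵖ suc (suc M)) ⟩
    𝟙 ⊖ g ^ᵖ suc (suc M) ∎
    where open SetoidReasoning P.setoid

  inv-inverseʳ : ∀ {f} → ConstantTermOne f → f ⊗ inv f ≋ 𝟙
  inv-inverseʳ {f} f≈1 = T.≈[]-all⇒≋ λ N →
    let module TN = CommutativeRing (T.truncRing N)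
        module TL = RingLemmas (T.truncRing N)
        open SetoidReasoning TN.setoid
    in begin
    f ⊗ inv f                ≈⟨ TN.*-cong (T.≋⇒≈[] (P.sym (PL.1-[1-x]≈x f)))
                                          (Σ∞-truncate (λ n → T.Ord≥-^ᵖ n g≈0) (ℕ.n≤1+n N)) ⟩
    (𝟙 ⊖ g) ⊗ ΣP≤ N (g ^ᵖ_)  ≈⟨ T.≋⇒≈[] (geometric-sum g N) ⟩
    𝟙 ⊖ g ^ᵖ suc N           ≈⟨ TN.+-congˡ (TN.-‿cong (T.Ord≥-weaken (ℕ.n≤1+n N) (T.Ord≥-^ᵖ (suc N) g≈0))) ⟩
    𝟙 ⊖ 𝟘                    ≈⟨ TL.x-0≈x 𝟙 ⟩
    𝟙                        ∎
    where
    g = 𝟙 ⊖ f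
    g≈0 : T.Ord≥ 1 g
    g≈0 = T₁L.x≈y⇒x∙y⁻¹≈ε (T₁.sym f≈1)

  inv-unique : ∀ {f u} → ConstantTermOne f → f ⊗ u ≋ 𝟙 → u ≋ inv f
  inv-unique f≈1 fu≋1 = PL.*-inverse-unique fu≋1 (inv-inverseʳ f≈1)

  inv-⊗ : ∀ {f g} → ConstantTermOne f → ConstantTermOne g → inv (f ⊗ g) ≋ inv f ⊗ inv g
  inv-⊗ {f} {g} f≈1 g≈1 = P.sym (inv-unique (ConstantTermOne-⊗ f≈1 g≈1)
    (P.trans (interchange f g (inv f) (inv g))
      (P.trans (P.*-cong (inv-inverseʳ f≈1) (inv-inverseʳ g≈1)) (P.*-identityʳ 𝟙))))
    where open CommutativeSemigroupProperties P.*-commutativeSemigroup using (interchange)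

  inv-𝟙 : inv 𝟙 ≋ 𝟙
  inv-𝟙 = P.sym (inv-unique T₁.refl (P.*-identityʳ 𝟙))

  ⊗≋⇒≋⊗inv : ∀ {f g h} → ConstantTermOne f → f ⊗ g ≋ h → g ≋ h ⊗ inv f
  ⊗≋⇒≋⊗inv {f} {g} {h} f≈1 fg≋h = begin
    g                ≈⟨ P.*-identityʳ g ⟨
    g ⊗ 𝟙            ≈⟨ P.*-congˡ (inv-inverseʳ f≈1) ⟨
    g ⊗ (f ⊗ inv f)  ≈⟨ x∙yz≈yx∙z g f (inv f) ⟩
    (f ⊗ g) ⊗ inv f  ≈⟨ P.*-congʳ {inv f} fg≋h ⟩
    h ⊗ inv f        ∎
    where
    open SetoidReasoning P.setoid
    open CommutativeSemigroupProperties P.*-commutativeSemigroup using (x∙yz≈yx∙z)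

module QBinomial {c ℓ} (R : CommutativeRing c ℓ) where
  open Series R renaming (_≋_ to infix 4 _≋_)
  open PowerSeriesRing R
  open Truncation R
  open SeriesSums R
  open Pochhammer R
  open Inverses R
  open CommutativeMonoidSolver P.*-commutativeMonoid using (solve; _⊜_) renaming (_⊕_ to _·_)

  φ₁₀-term : PS → PS → ℕ → PS
  φ₁₀-term A x n = poch A n ⊗ inv (poch 𝐪 n) ⊗ x ^ᵖ n

  φ₁₀ : PS → PS → PS
  φ₁₀ A x = Σ∞ (φ₁₀-term A x)

  ConstantTermOne-poch𝐪 : ∀ n → ConstantTermOne (poch 𝐪 n)
  ConstantTermOne-poch𝐪 = ConstantTermOne-poch 𝐪-Ord≥1

  inv-poch𝐪-suc : ∀ n → inv (poch 𝐪 (suc n)) ⊗ (𝟙 ⊖ 𝐪 ^ᵖ suc n) ≋ inv (poch 𝐪 n)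
  inv-poch𝐪-suc n = inv-unique (ConstantTermOne-poch𝐪 n) (begin
    poch 𝐪 n ⊗ (inv (poch 𝐪 (suc n)) ⊗ (𝟙 ⊖ 𝐪 ^ᵖ suc n))
      ≈⟨ solve 3 (λ a b c → a · (b · c) ⊜ (a · c) · b) P.refl (poch 𝐪 n) (inv (poch 𝐪 (suc n))) (𝟙 ⊖ 𝐪 ^ᵖ suc n) ⟩
    poch 𝐪 (suc n) ⊗ inv (poch 𝐪 (suc n))
      ≈⟨ inv-inverseʳ (ConstantTermOne-poch𝐪 (suc n)) ⟩
    𝟙 ∎)
    where open SetoidReasoning P.setoid

  φ₁₀-term-summable : ∀ A {x} → T.Ord≥ 1 x → Summable (φ₁₀-term A x)
  φ₁₀-term-summable A {x} x≈0 n = T.Ord≥-⊗ʳ {n} {x ^ᵖ n} (poch A n ⊗ inv (poch 𝐪 n)) (T.Ord≥-^ᵖ n x≈0)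

  φ₁₀-cong : ∀ A {x y} → x ≋ y → φ₁₀ A x ≋ φ₁₀ A y
  φ₁₀-cong A x≋y = Σ∞-cong λ n → P.*-congˡ (^ᵖ-cong n x≋y)

  φ₁₀-term-⊗ : ∀ A x y n → φ₁₀-term A (x ⊗ y) n ≋ φ₁₀-term A x n ⊗ y ^ᵖ n
  φ₁₀-term-⊗ A x y n = P.trans (P.*-congˡ (^ᵖ-distrib-⊗ x y n))
    (P.sym (P.*-assoc (poch A n ⊗ inv (poch 𝐪 n)) (x ^ᵖ n) (y ^ᵖ n)))

  φ₁₀-term-difference : ∀ A x n →
    φ₁₀-term A x (suc n) ⊖ φ₁₀-term A (x ⊗ 𝐪) (suc n) ≋ x ⊗ φ₁₀-term A x n ⊖ (A ⊗ x) ⊗ φ₁₀-term A (x ⊗ 𝐪) n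
  φ₁₀-term-difference A x n = begin
    t (suc n) ⊖ t′ (suc n)
      ≈⟨ P.+-congˡ {t (suc n)} (P.-‿cong (φ₁₀-term-⊗ A x 𝐪 (suc n))) ⟩
    t (suc n) ⊖ t (suc n) ⊗ 𝐪 ^ᵖ suc n
      ≈⟨ PL.x[1-y]≈x-xy (t (suc n)) (𝐪 ^ᵖ suc n) ⟨
    t (suc n) ⊗ (𝟙 ⊖ 𝐪 ^ᵖ suc n)
      ≈⟨ solve 5 (λ a i x xⁿ d → ((a · i) · (x · xⁿ)) · d ⊜ (a · (x · xⁿ)) · (i · d)) P.refl
                 (poch A (suc n)) (inv (poch 𝐪 (suc n))) x (x ^ᵖ n) (𝟙 ⊖ 𝐪 ^ᵖ suc n) ⟩
    (poch A (suc n) ⊗ (x ⊗ x ^ᵖ n)) ⊗ (inv (poch 𝐪 (suc n)) ⊗ (𝟙 ⊖ 𝐪 ^ᵖ suc n))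
      ≈⟨ P.*-congˡ (inv-poch𝐪-suc n) ⟩
    (poch A (suc n) ⊗ (x ⊗ x ^ᵖ n)) ⊗ inv (poch 𝐪 n)
      ≈⟨ solve 5 (λ a d x xⁿ i → ((a · d) · (x · xⁿ)) · i ⊜ (((a · i) · xⁿ) · x) · d) P.refl
                 (poch A n) (𝟙 ⊖ A ⊗ 𝐪 ^ᵖ n) x (x ^ᵖ n) (inv (poch 𝐪 n)) ⟩
    (t n ⊗ x) ⊗ (𝟙 ⊖ A ⊗ 𝐪 ^ᵖ n)
      ≈⟨ PL.x[1-y]≈x-xy (t n ⊗ x) (A ⊗ 𝐪 ^ᵖ n) ⟩
    t n ⊗ x ⊖ (t n ⊗ x) ⊗ (A ⊗ 𝐪 ^ᵖ n)
      ≈⟨ P.+-cong (P.*-comm (t n) x) (P.-‿cong (P.sym Ax⊗t′[n]≋)) ⟩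
    x ⊗ t n ⊖ (A ⊗ x) ⊗ t′ n ∎
    where
    open SetoidReasoning P.setoid
    t t′ : ℕ → PS
    t  = φ₁₀-term A x
    t′ = φ₁₀-term A (x ⊗ 𝐪)

    Ax⊗t′[n]≋ : (A ⊗ x) ⊗ t′ n ≋ (t n ⊗ x) ⊗ (A ⊗ 𝐪 ^ᵖ n)
    Ax⊗t′[n]≋ = P.trans (P.*-congˡ (φ₁₀-term-⊗ A x 𝐪 n))
      (solve 4 (λ t x A qⁿ → (A · x) · (t · qⁿ) ⊜ (t · x) · (A · qⁿ)) P.refl (t n) x A (𝐪 ^ᵖ n))

  φ₁₀≈[]partial-sum : ∀ A {x} → T.Ord≥ 1 x → ∀ {N} M → N ≤ suc M →
                      φ₁₀ A x T.≈[ N ] Series.Σ≤ (T.truncRing N) M (φ₁₀-term A x)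
  φ₁₀≈[]partial-sum A x≈0 {N} M N≤1+M = CommutativeRing.trans (T.truncRing N)
    (Σ∞-truncate (φ₁₀-term-summable A x≈0) N≤1+M) (ΣP≤≈[]Σ≤ N M _)

  φ₁₀-difference : ∀ A {x} → T.Ord≥ 1 x → ∀ N →
    φ₁₀ A x ⊖ φ₁₀ A (x ⊗ 𝐪) T.≈[ N ] x ⊗ φ₁₀ A x ⊖ (A ⊗ x) ⊗ φ₁₀ A (x ⊗ 𝐪)
  φ₁₀-difference A {x} x≈0 N = begin
    φ₁₀ A x ⊖ φ₁₀ A (x ⊗ 𝐪)
      ≈⟨ TN.+-cong (partial x≈0 (suc N) N≤2+N) (TN.-‿cong (partial xq≈0 (suc N) N≤2+N)) ⟩
    Σ (suc N) t ⊖ Σ (suc N) t′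
      ≈⟨ ΣN.Σ≤-distrib-minus (suc N) t t′ ⟨
    Σ (suc N) (λ n → t n ⊖ t′ n)
      ≈⟨ ΣN.Σ≤-suc N (λ n → t n ⊖ t′ n) ⟩
    (t 0 ⊖ t′ 0) ⊕ Σ N (λ n → t (suc n) ⊖ t′ (suc n))
      ≈⟨ TN.+-cong (TN.-‿inverseʳ (t 0)) (ΣN.Σ≤-cong N (λ n → T.≋⇒≈[] (φ₁₀-term-difference A x n))) ⟩
    𝟘 ⊕ Σ N (λ n → x ⊗ t n ⊖ (A ⊗ x) ⊗ t′ n)
      ≈⟨ TN.+-identityˡ _ ⟩
    Σ N (λ n → x ⊗ t n ⊖ (A ⊗ x) ⊗ t′ n)
      ≈⟨ ΣN.Σ≤-distrib-minus N (λ n → x ⊗ t n) (λ n → (A ⊗ x) ⊗ t′ n) ⟩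
    Σ N (λ n → x ⊗ t n) ⊖ Σ N (λ n → (A ⊗ x) ⊗ t′ n)
      ≈⟨ TN.+-cong (ΣN.*-distribˡ-Σ≤ N x t) (TN.-‿cong (ΣN.*-distribˡ-Σ≤ N (A ⊗ x) t′)) ⟨
    x ⊗ Σ N t ⊖ (A ⊗ x) ⊗ Σ N t′
      ≈⟨ TN.+-cong (TN.*-congˡ (partial x≈0 N N≤1+N)) (TN.-‿cong (TN.*-congˡ (partial xq≈0 N N≤1+N))) ⟨
    x ⊗ φ₁₀ A x ⊖ (A ⊗ x) ⊗ φ₁₀ A (x ⊗ 𝐪) ∎
    where
    module TN = CommutativeRing (T.truncRing N)
    module ΣN = FiniteSum (T.truncRing N)
    open SetoidReasoning TN.setoid
    Σ = Series.Σ≤ (T.truncRing N)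
    t t′ : ℕ → PS
    t  = φ₁₀-term A x
    t′ = φ₁₀-term A (x ⊗ 𝐪)
    xq≈0 = T.Ord≥-⊗ˡ {1} {x} 𝐪 x≈0
    partial = λ {y} y≈0 → φ₁₀≈[]partial-sum A {y} y≈0 {N}
    N≤1+N = ℕ.n≤1+n N
    N≤2+N = ℕ.m≤n⇒m≤1+n N≤1+N

  φ₁₀-functional-equation : ∀ A {x} → T.Ord≥ 1 x →
    (𝟙 ⊖ x) ⊗ φ₁₀ A x ≋ (𝟙 ⊖ A ⊗ x) ⊗ φ₁₀ A (x ⊗ 𝐪)
  φ₁₀-functional-equation A {x} x≈0 = T.≈[]-all⇒≋ λ N →
    let module TN = CommutativeRing (T.truncRing N)
        module TL = RingLemmas (T.truncRing N)
        open SetoidReasoning TN.setoid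
    in begin
    (𝟙 ⊖ x) ⊗ φ₁₀ A x                  ≈⟨ TL.[1-x]y≈y-xy x (φ₁₀ A x) ⟩
    φ₁₀ A x ⊖ x ⊗ φ₁₀ A x              ≈⟨ TL.x-y≈z-w⇒x-z≈y-w (φ₁₀-difference A x≈0 N) ⟩
    φ₁₀ A (x ⊗ 𝐪) ⊖ (A ⊗ x) ⊗ φ₁₀ A (x ⊗ 𝐪)  ≈⟨ TL.[1-x]y≈y-xy (A ⊗ x) (φ₁₀ A (x ⊗ 𝐪)) ⟨
    (𝟙 ⊖ A ⊗ x) ⊗ φ₁₀ A (x ⊗ 𝐪)        ∎

  φ₁₀-iterate : ∀ A {x} → T.Ord≥ 1 x → ∀ M →
    poch x M ⊗ φ₁₀ A x ≋ poch (A ⊗ x) M ⊗ φ₁₀ A (x ⊗ 𝐪 ^ᵖ M)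
  φ₁₀-iterate A {x} x≈0 zero    = P.*-congˡ (φ₁₀-cong A (P.sym (P.*-identityʳ x)))
  φ₁₀-iterate A {x} x≈0 (suc M) = begin
    (poch x M ⊗ (𝟙 ⊖ y)) ⊗ φ₁₀ A x
      ≈⟨ xy∙z≈y∙xz (poch x M) (𝟙 ⊖ y) (φ₁₀ A x) ⟩
    (𝟙 ⊖ y) ⊗ (poch x M ⊗ φ₁₀ A x)
      ≈⟨ P.*-congˡ (φ₁₀-iterate A x≈0 M) ⟩
    (𝟙 ⊖ y) ⊗ (poch (A ⊗ x) M ⊗ φ₁₀ A y)
      ≈⟨ x∙yz≈y∙xz (𝟙 ⊖ y) (poch (A ⊗ x) M) (φ₁₀ A y) ⟩
    poch (A ⊗ x) M ⊗ ((𝟙 ⊖ y) ⊗ φ₁₀ A y)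
      ≈⟨ P.*-congˡ (φ₁₀-functional-equation A (T.Ord≥-⊗ˡ {1} {x} (𝐪 ^ᵖ M) x≈0)) ⟩
    poch (A ⊗ x) M ⊗ ((𝟙 ⊖ A ⊗ y) ⊗ φ₁₀ A (y ⊗ 𝐪))
      ≈⟨ P.*-congˡ (P.*-cong (P.+-congˡ {𝟙} (P.-‿cong (P.sym (P.*-assoc A x (𝐪 ^ᵖ M)))))
                             (φ₁₀-cong A (xy∙z≈x∙zy x (𝐪 ^ᵖ M) 𝐪))) ⟩
    poch (A ⊗ x) M ⊗ ((𝟙 ⊖ (A ⊗ x) ⊗ 𝐪 ^ᵖ M) ⊗ φ₁₀ A (x ⊗ 𝐪 ^ᵖ suc M))
      ≈⟨ P.*-assoc (poch (A ⊗ x) M) (𝟙 ⊖ (A ⊗ x) ⊗ 𝐪 ^ᵖ M) (φ₁₀ A (x ⊗ 𝐪 ^ᵖ suc M)) ⟨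
    poch (A ⊗ x) (suc M) ⊗ φ₁₀ A (x ⊗ 𝐪 ^ᵖ suc M) ∎
    where
    open SetoidReasoning P.setoid
    open CommutativeSemigroupProperties P.*-commutativeSemigroup using (xy∙z≈y∙xz; x∙yz≈y∙xz; xy∙z≈x∙zy)
    y = x ⊗ 𝐪 ^ᵖ M

  φ₁₀≈[]𝟙 : ∀ A {y N} → T.Ord≥ N y → φ₁₀ A y T.≈[ N ] 𝟙
  φ₁₀≈[]𝟙 A {y} {N} y≈0 = CommutativeRing.trans (T.truncRing N) (Σ∞-head tail≈0) (T.≋⇒≈[] term₀≋𝟙)
    where
    tail≈0 : ∀ n → T.Ord≥ N (φ₁₀-term A y (suc n))
    tail≈0 n = T.Ord≥-⊗ʳ {N} {y ^ᵖ suc n} (poch A (suc n) ⊗ inv (poch 𝐪 (suc n))) (T.Ord≥-⊗ˡ {N} {y} (y ^ᵖ n) y≈0)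

    term₀≋𝟙 : φ₁₀-term A y 0 ≋ 𝟙
    term₀≋𝟙 = P.trans (P.*-identityʳ (𝟙 ⊗ inv 𝟙)) (P.trans (P.*-identityˡ (inv 𝟙)) inv-𝟙)

  q-binomial : ∀ A {x} → T.Ord≥ 1 x → pochInf x ⊗ φ₁₀ A x ≋ pochInf (A ⊗ x)
  q-binomial A {x} x≈0 = T.≈[]-all⇒≋ λ N →
    let module TN = CommutativeRing (T.truncRing N)
        open SetoidReasoning TN.setoid
    in begin
    pochInf x ⊗ φ₁₀ A x
      ≈⟨ TN.*-congʳ {φ₁₀ A x} (Q⇒T {N} {pochInf x} (pochInf≈[]poch x ℕ.≤-refl)) ⟩
    poch x N ⊗ φ₁₀ A x
      ≈⟨ T.≋⇒≈[] (φ₁₀-iterate A x≈0 N) ⟩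
    poch (A ⊗ x) N ⊗ φ₁₀ A (x ⊗ 𝐪 ^ᵖ N)
      ≈⟨ TN.*-congˡ (φ₁₀≈[]𝟙 A (⊗𝐪^-Ord≥ x N)) ⟩
    poch (A ⊗ x) N ⊗ 𝟙
      ≈⟨ TN.*-identityʳ (poch (A ⊗ x) N) ⟩
    poch (A ⊗ x) N
      ≈⟨ Q⇒T {N} {pochInf (A ⊗ x)} (pochInf≈[]poch (A ⊗ x) ℕ.≤-refl) ⟨
    pochInf (A ⊗ x) ∎

module Expansion {c ℓ} (R : CommutativeRing c ℓ) (a : CommutativeRing.Carrier R) where
  open CommutativeRing R using (1#)
  open Series R renaming (_≋_ to infix 4 _≋_)
  open PowerSeriesRing R
  open Truncation R
  open SeriesSums R
  open Pochhammer R
  open Inverses R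
  open QBinomial R
  open CommutativeMonoidSolver P.*-commutativeMonoid using (solve; _⊜_) renaming (_⊕_ to _·_)

  A : PS
  A = const a

  𝐛-Ord≥1 : T.Ord≥ 1 𝐛
  𝐛-Ord≥1 = mono-Ord≥1 1# 0 1 0 0 (s≤s z≤n)

  𝐜-Ord≥1 : T.Ord≥ 1 𝐜
  𝐜-Ord≥1 = mono-Ord≥1 1# 0 0 1 0 (s≤s z≤n)

  𝐳-Ord≥1 : T.Ord≥ 1 𝐳
  𝐳-Ord≥1 = mono-Ord≥1 1# 0 0 0 1 (s≤s z≤n)

  E : PS → PS
  E = φ₁₀ 𝟘

  euler : ∀ {y} → T.Ord≥ 1 y → pochInf y ⊗ E y ≋ 𝟙
  euler {y} y≈0 = P.trans (q-binomial 𝟘 y≈0) (pochInf-𝟘 (P.zeroˡ y))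

  poch≋pochInf⊗E : ∀ {x} → T.Ord≥ 1 x → ∀ n → poch x n ≋ pochInf x ⊗ E (x ⊗ 𝐪 ^ᵖ n)
  poch≋pochInf⊗E {x} x≈0 n = P.sym (begin
    pochInf x ⊗ E y               ≈⟨ P.*-congʳ {E y} (pochInf-split x n) ⟩
    (poch x n ⊗ pochInf y) ⊗ E y  ≈⟨ P.*-assoc (poch x n) (pochInf y) (E y) ⟩
    poch x n ⊗ (pochInf y ⊗ E y)  ≈⟨ P.*-congˡ (euler (T.Ord≥-⊗ˡ {1} {x} (𝐪 ^ᵖ n) x≈0)) ⟩
    poch x n ⊗ 𝟙                  ≈⟨ P.*-identityʳ (poch x n) ⟩
    poch x n                      ∎)
    where
    open SetoidReasoning P.setoid
    y = x ⊗ 𝐪 ^ᵖ n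

  E-term≋ : ∀ x n → φ₁₀-term 𝟘 x n ≋ inv (poch 𝐪 n) ⊗ x ^ᵖ n
  E-term≋ x n = P.*-congʳ {x ^ᵖ n} (P.trans (P.*-congʳ {inv (poch 𝐪 n)} (poch-𝟘 n P.refl))
                                             (P.*-identityˡ (inv (poch 𝐪 n))))

  β γ t G : ℕ → PS
  β j = φ₁₀-term 𝟘 𝐛 j
  γ k = φ₁₀-term 𝟘 𝐜 k
  t n = φ₁₀-term A 𝐳 n
  G m = poch 𝐳 m ⊗ inv (poch (A ⊗ 𝐳) m)

  -- Both sides equal (b;q)∞ (c;q)∞ (az;q)∞/(z;q)∞ · Σ_{j,k} H j k.
  H : ℕ → ℕ → PS
  H j k = (β j ⊗ γ k) ⊗ G (j +ℕ k)

  H-Ord≥ : ∀ j k → T.Ord≥ (j +ℕ k) (H j k)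
  H-Ord≥ j k = T.Ord≥-⊗ˡ {j +ℕ k} {β j ⊗ γ k} (G (j +ℕ k))
    (T.Ord≥-⊗ {j} {k} {β j} {γ k} (φ₁₀-term-summable 𝟘 𝐛-Ord≥1 j) (φ₁₀-term-summable 𝟘 𝐜-Ord≥1 k))

  square : ℕ → PS
  square N = Series.Σ≤ (T.truncRing N) N (λ j → Series.Σ≤ (T.truncRing N) N (H j))

  b∞ c∞ z∞ az∞ ratio : PS
  b∞ = pochInf 𝐛
  c∞ = pochInf 𝐜
  z∞ = pochInf 𝐳
  az∞ = pochInf (A ⊗ 𝐳)
  ratio = az∞ ⊗ inv z∞

  φ₁₀-at-𝐳𝐪^ : ∀ m → φ₁₀ A (𝐳 ⊗ 𝐪 ^ᵖ m) ≋ ratio ⊗ G m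
  φ₁₀-at-𝐳𝐪^ m = begin
    φ₁₀ A y
      ≈⟨ ⊗≋⇒≋⊗inv (ConstantTermOne-pochInf y≈0) (q-binomial A y≈0) ⟩
    pochInf (A ⊗ y) ⊗ inv (pochInf y)
      ≈⟨ P.*-cong Ay∞≋ (P.sym y∞⁻¹≋) ⟩
    (az∞ ⊗ inv (poch (A ⊗ 𝐳) m)) ⊗ (poch 𝐳 m ⊗ inv z∞)
      ≈⟨ solve 4 (λ u v w x → (u · v) · (w · x) ⊜ (u · x) · (w · v)) P.refl
               az∞ (inv (poch (A ⊗ 𝐳) m)) (poch 𝐳 m) (inv z∞) ⟩
    ratio ⊗ G m ∎
    where
    open SetoidReasoning P.setoid
    y = 𝐳 ⊗ 𝐪 ^ᵖ m
    y≈0 = T.Ord≥-⊗ˡ {1} {𝐳} (𝐪 ^ᵖ m) 𝐳-Ord≥1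

    Ay∞≋ : pochInf (A ⊗ y) ≋ az∞ ⊗ inv (poch (A ⊗ 𝐳) m)
    Ay∞≋ = ⊗≋⇒≋⊗inv (ConstantTermOne-poch (T.Ord≥-⊗ʳ {1} {𝐳} A 𝐳-Ord≥1) m)
      (P.sym (P.trans (pochInf-split (A ⊗ 𝐳) m) (P.*-congˡ (pochInf-cong (P.*-assoc A 𝐳 (𝐪 ^ᵖ m))))))

    y∞⁻¹≋ : poch 𝐳 m ⊗ inv z∞ ≋ inv (pochInf y)
    y∞⁻¹≋ = inv-unique (ConstantTermOne-pochInf y≈0) (begin
      pochInf y ⊗ (poch 𝐳 m ⊗ inv z∞)
        ≈⟨ P.*-assoc (pochInf y) (poch 𝐳 m) (inv z∞) ⟨
      (pochInf y ⊗ poch 𝐳 m) ⊗ inv z∞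
        ≈⟨ P.*-congʳ {inv z∞} (P.trans (P.*-comm (pochInf y) (poch 𝐳 m)) (P.sym (pochInf-split 𝐳 m))) ⟩
      z∞ ⊗ inv z∞
        ≈⟨ inv-inverseʳ (ConstantTermOne-pochInf 𝐳-Ord≥1) ⟩
      𝟙 ∎)

  [𝐪ⁿ]ʲ⊗[𝐪ⁿ]ᵏ≋[𝐪ʲ⁺ᵏ]ⁿ : ∀ n j k → (𝐪 ^ᵖ n) ^ᵖ j ⊗ (𝐪 ^ᵖ n) ^ᵖ k ≋ (𝐪 ^ᵖ (j +ℕ k)) ^ᵖ n
  [𝐪ⁿ]ʲ⊗[𝐪ⁿ]ᵏ≋[𝐪ʲ⁺ᵏ]ⁿ n j k = begin
    (𝐪 ^ᵖ n) ^ᵖ j ⊗ (𝐪 ^ᵖ n) ^ᵖ k  ≈⟨ P.*-cong (^ᵖ-assocʳ 𝐪 n j) (^ᵖ-assocʳ 𝐪 n k) ⟩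
    𝐪 ^ᵖ (n *ℕ j) ⊗ 𝐪 ^ᵖ (n *ℕ k)  ≈⟨ ^ᵖ-homo-⊗ 𝐪 (n *ℕ j) (n *ℕ k) ⟨
    𝐪 ^ᵖ (n *ℕ j +ℕ n *ℕ k)        ≡⟨ ≡.cong (𝐪 ^ᵖ_) (≡.trans (≡.sym (ℕ.*-distribˡ-+ n j k)) (ℕ.*-comm n (j +ℕ k))) ⟩
    𝐪 ^ᵖ ((j +ℕ k) *ℕ n)           ≈⟨ ^ᵖ-assocʳ 𝐪 (j +ℕ k) n ⟨
    (𝐪 ^ᵖ (j +ℕ k)) ^ᵖ n           ∎
    where open SetoidReasoning P.setoid

  t⊗E-terms≋ : ∀ n j k →
    t n ⊗ (φ₁₀-term 𝟘 (𝐛 ⊗ 𝐪 ^ᵖ n) j ⊗ φ₁₀-term 𝟘 (𝐜 ⊗ 𝐪 ^ᵖ n) k) ≋ (β j ⊗ γ k) ⊗ φ₁₀-term A (𝐳 ⊗ 𝐪 ^ᵖ (j +ℕ k)) n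
  t⊗E-terms≋ n j k = begin
    t n ⊗ (φ₁₀-term 𝟘 (𝐛 ⊗ 𝐪 ^ᵖ n) j ⊗ φ₁₀-term 𝟘 (𝐜 ⊗ 𝐪 ^ᵖ n) k)
      ≈⟨ P.*-congˡ (P.*-cong (φ₁₀-term-⊗ 𝟘 𝐛 (𝐪 ^ᵖ n) j) (φ₁₀-term-⊗ 𝟘 𝐜 (𝐪 ^ᵖ n) k)) ⟩
    t n ⊗ ((β j ⊗ (𝐪 ^ᵖ n) ^ᵖ j) ⊗ (γ k ⊗ (𝐪 ^ᵖ n) ^ᵖ k))
      ≈⟨ solve 5 (λ t b qʲ c qᵏ → t · ((b · qʲ) · (c · qᵏ)) ⊜ (b · c) · (t · (qʲ · qᵏ))) P.refl
               (t n) (β j) ((𝐪 ^ᵖ n) ^ᵖ j) (γ k) ((𝐪 ^ᵖ n) ^ᵖ k) ⟩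
    (β j ⊗ γ k) ⊗ (t n ⊗ ((𝐪 ^ᵖ n) ^ᵖ j ⊗ (𝐪 ^ᵖ n) ^ᵖ k))
      ≈⟨ P.*-congˡ (P.*-congˡ ([𝐪ⁿ]ʲ⊗[𝐪ⁿ]ᵏ≋[𝐪ʲ⁺ᵏ]ⁿ n j k)) ⟩
    (β j ⊗ γ k) ⊗ (t n ⊗ (𝐪 ^ᵖ (j +ℕ k)) ^ᵖ n)
      ≈⟨ P.*-congˡ (φ₁₀-term-⊗ A 𝐳 (𝐪 ^ᵖ (j +ℕ k)) n) ⟨
    (β j ⊗ γ k) ⊗ φ₁₀-term A (𝐳 ⊗ 𝐪 ^ᵖ (j +ℕ k)) n ∎
    where open SetoidReasoning P.setoid

  φ₃₂-term : ℕ → PS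
  φ₃₂-term n = poch A n ⊗ poch 𝐛 n ⊗ poch 𝐜 n ⊗ inv (poch 𝐪 n) ⊗ 𝐳 ^ᵖ n

  φ₃₂-term-summable : Summable φ₃₂-term
  φ₃₂-term-summable n =
    T.Ord≥-⊗ʳ {n} {𝐳 ^ᵖ n} (poch A n ⊗ poch 𝐛 n ⊗ poch 𝐜 n ⊗ inv (poch 𝐪 n)) (T.Ord≥-^ᵖ n 𝐳-Ord≥1)

  φ₃₂-term≋ : ∀ n → φ₃₂-term n ≋ (b∞ ⊗ c∞) ⊗ (t n ⊗ (E (𝐛 ⊗ 𝐪 ^ᵖ n) ⊗ E (𝐜 ⊗ 𝐪 ^ᵖ n)))
  φ₃₂-term≋ n = P.trans
    (P.*-congʳ {𝐳 ^ᵖ n} (P.*-congʳ {inv (poch 𝐪 n)}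
      (P.*-cong (P.*-congˡ (poch≋pochInf⊗E 𝐛-Ord≥1 n)) (poch≋pochInf⊗E 𝐜-Ord≥1 n))))
    (solve 7 (λ a b eb c ec i z → (((a · (b · eb)) · (c · ec)) · i) · z ⊜ (b · c) · (((a · i) · z) · (eb · ec)))
           P.refl (poch A n) b∞ (E (𝐛 ⊗ 𝐪 ^ᵖ n)) c∞ (E (𝐜 ⊗ 𝐪 ^ᵖ n)) (inv (poch 𝐪 n)) (𝐳 ^ᵖ n))

  hb-summand≋ : ∀ m k → (qbin m k ⊗ 𝐜 ^ᵖ k ⊗ 𝐛 ^ᵖ (m ∸ k)) ⊗ inv (poch 𝐪 m) ≋ γ k ⊗ β (m ∸ k)
  hb-summand≋ m k = begin
    (((poch 𝐪 m ⊗ I) ⊗ 𝐜 ^ᵖ k) ⊗ 𝐛 ^ᵖ (m ∸ k)) ⊗ inv (poch 𝐪 m)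
      ≈⟨ solve 5 (λ p i c b p⁻¹ → (((p · i) · c) · b) · p⁻¹ ⊜ (p · p⁻¹) · ((i · c) · b)) P.refl
               (poch 𝐪 m) I (𝐜 ^ᵖ k) (𝐛 ^ᵖ (m ∸ k)) (inv (poch 𝐪 m)) ⟩
    (poch 𝐪 m ⊗ inv (poch 𝐪 m)) ⊗ ((I ⊗ 𝐜 ^ᵖ k) ⊗ 𝐛 ^ᵖ (m ∸ k))
      ≈⟨ P.trans (P.*-congʳ {(I ⊗ 𝐜 ^ᵖ k) ⊗ 𝐛 ^ᵖ (m ∸ k)} (inv-inverseʳ (ConstantTermOne-poch𝐪 m))) (P.*-identityˡ _) ⟩
    (I ⊗ 𝐜 ^ᵖ k) ⊗ 𝐛 ^ᵖ (m ∸ k)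
      ≈⟨ P.*-congʳ {𝐛 ^ᵖ (m ∸ k)} (P.*-congʳ {𝐜 ^ᵖ k} (inv-⊗ (ConstantTermOne-poch𝐪 k) (ConstantTermOne-poch𝐪 (m ∸ k)))) ⟩
    ((inv (poch 𝐪 k) ⊗ inv (poch 𝐪 (m ∸ k))) ⊗ 𝐜 ^ᵖ k) ⊗ 𝐛 ^ᵖ (m ∸ k)
      ≈⟨ solve 4 (λ u v c b → ((u · v) · c) · b ⊜ (u · c) · (v · b)) P.refl
               (inv (poch 𝐪 k)) (inv (poch 𝐪 (m ∸ k))) (𝐜 ^ᵖ k) (𝐛 ^ᵖ (m ∸ k)) ⟩
    (inv (poch 𝐪 k) ⊗ 𝐜 ^ᵖ k) ⊗ (inv (poch 𝐪 (m ∸ k)) ⊗ 𝐛 ^ᵖ (m ∸ k))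
      ≈⟨ P.*-cong (E-term≋ 𝐜 k) (E-term≋ 𝐛 (m ∸ k)) ⟨
    γ k ⊗ β (m ∸ k) ∎
    where
    open SetoidReasoning P.setoid
    I = inv (poch 𝐪 k ⊗ poch 𝐪 (m ∸ k))

  hb-Ord≥ : ∀ n → T.Ord≥ n (hb n)
  hb-Ord≥ n = ΣP≤-Ord≥ n _ λ k k≤n → ≡.subst (λ e → T.Ord≥ e (qbin n k ⊗ 𝐜 ^ᵖ k ⊗ 𝐛 ^ᵖ (n ∸ k))) (ℕ.m+[n∸m]≡n k≤n)
    (T.Ord≥-⊗ {k} {n ∸ k} {qbin n k ⊗ 𝐜 ^ᵖ k} {𝐛 ^ᵖ (n ∸ k)}
      (T.Ord≥-⊗ʳ {k} {𝐜 ^ᵖ k} (qbin n k) (T.Ord≥-^ᵖ k 𝐜-Ord≥1)) (T.Ord≥-^ᵖ (n ∸ k) 𝐛-Ord≥1))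

  rhs-term : ℕ → PS
  rhs-term n = hb n ⊗ poch 𝐳 n ⊗ inv (poch (A ⊗ 𝐳) n ⊗ poch 𝐪 n)

  rhs-term-summable : Summable rhs-term
  rhs-term-summable n = T.Ord≥-⊗ˡ {n} {hb n ⊗ poch 𝐳 n} (inv (poch (A ⊗ 𝐳) n ⊗ poch 𝐪 n))
                          (T.Ord≥-⊗ˡ {n} {hb n} (poch 𝐳 n) (hb-Ord≥ n))

  rhs-term≋ : ∀ m → rhs-term m ≋ ΣP≤ m (λ k → γ k ⊗ β (m ∸ k)) ⊗ G m
  rhs-term≋ m = begin
    (hb m ⊗ poch 𝐳 m) ⊗ inv (poch (A ⊗ 𝐳) m ⊗ poch 𝐪 m)
      ≈⟨ P.*-congˡ (inv-⊗ (ConstantTermOne-poch (T.Ord≥-⊗ʳ {1} {𝐳} A 𝐳-Ord≥1) m) (ConstantTermOne-poch𝐪 m)) ⟩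
    (hb m ⊗ poch 𝐳 m) ⊗ (inv (poch (A ⊗ 𝐳) m) ⊗ inv (poch 𝐪 m))
      ≈⟨ solve 4 (λ h z u v → (h · z) · (u · v) ⊜ (h · v) · (z · u)) P.refl
               (hb m) (poch 𝐳 m) (inv (poch (A ⊗ 𝐳) m)) (inv (poch 𝐪 m)) ⟩
    (hb m ⊗ inv (poch 𝐪 m)) ⊗ G m
      ≈⟨ P.*-congʳ {G m} (P.trans (*-distribʳ-ΣP≤ m (inv (poch 𝐪 m)) _) (ΣP≤-cong m (hb-summand≋ m))) ⟩
    ΣP≤ m (λ k → γ k ⊗ β (m ∸ k)) ⊗ G m ∎
    where open SetoidReasoning P.setoid

  W : PS
  W = az∞ ⊗ b∞ ⊗ c∞ ⊗ inv z∞

  lhs-factor≋rhs-factor : ∀ Y → (b∞ ⊗ c∞) ⊗ (ratio ⊗ Y) ≋ W ⊗ Y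
  lhs-factor≋rhs-factor Y = solve 5 (λ b c a z⁻¹ y → (b · c) · ((a · z⁻¹) · y) ⊜ (((a · b) · c) · z⁻¹) · y) P.refl
                                    b∞ c∞ az∞ (inv z∞) Y

  X : ℕ → ℕ → ℕ → PS
  X n j k = (β j ⊗ γ k) ⊗ φ₁₀-term A (𝐳 ⊗ 𝐪 ^ᵖ (j +ℕ k)) n

  F : ℕ → ℕ → PS
  F k m = (γ k ⊗ β (m ∸ k)) ⊗ G m

  F≋H : ∀ k j → F k (k +ℕ j) ≋ H j k
  F≋H k j = P.trans (P.reflexive (≡.cong₂ (λ u v → (γ k ⊗ β u) ⊗ G v) (ℕ.m+n∸m≡n k j) (ℕ.+-comm k j)))
                    (P.*-congʳ {G (j +ℕ k)} (P.*-comm (γ k) (β j)))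

  F-Ord≥ : ∀ k j → T.Ord≥ (k +ℕ j) (F k (k +ℕ j))
  F-Ord≥ k j = CommutativeRing.trans (T.truncRing (k +ℕ j)) (T.≋⇒≈[] (F≋H k j))
                 (≡.subst (λ e → T.Ord≥ e (H j k)) (ℕ.+-comm j k) (H-Ord≥ j k))

  module _ (N : ℕ) where
    private
      module TN = CommutativeRing (T.truncRing N)
      module ΣN = FiniteSum (T.truncRing N)
      Σ = Series.Σ≤ (T.truncRing N)
      N≤1+N = ℕ.n≤1+n N
    open SetoidReasoning TN.setoid

    E⊗E≈[]double-sum : ∀ n →
      t n ⊗ (E (𝐛 ⊗ 𝐪 ^ᵖ n) ⊗ E (𝐜 ⊗ 𝐪 ^ᵖ n)) T.≈[ N ] Σ N (λ j → Σ N (λ k → X n j k))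
    E⊗E≈[]double-sum n = begin
      t n ⊗ (E y ⊗ E y′)
        ≈⟨ TN.*-congˡ (TN.*-cong (φ₁₀≈[]partial-sum 𝟘 y≈0 N N≤1+N) (φ₁₀≈[]partial-sum 𝟘 y′≈0 N N≤1+N)) ⟩
      t n ⊗ (Σ N (φ₁₀-term 𝟘 y) ⊗ Σ N (φ₁₀-term 𝟘 y′))
        ≈⟨ TN.*-congˡ (ΣN.Σ≤-*-Σ≤ N N (φ₁₀-term 𝟘 y) (φ₁₀-term 𝟘 y′)) ⟩
      t n ⊗ Σ N (λ j → Σ N (λ k → φ₁₀-term 𝟘 y j ⊗ φ₁₀-term 𝟘 y′ k))
        ≈⟨ TN.trans (ΣN.*-distribˡ-Σ≤ N (t n) _) (ΣN.Σ≤-cong N (λ j → ΣN.*-distribˡ-Σ≤ N (t n) _)) ⟩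
      Σ N (λ j → Σ N (λ k → t n ⊗ (φ₁₀-term 𝟘 y j ⊗ φ₁₀-term 𝟘 y′ k)))
        ≈⟨ ΣN.Σ≤-cong N (λ j → ΣN.Σ≤-cong N (λ k → T.≋⇒≈[] (t⊗E-terms≋ n j k))) ⟩
      Σ N (λ j → Σ N (λ k → X n j k)) ∎
      where
      y = 𝐛 ⊗ 𝐪 ^ᵖ n
      y′ = 𝐜 ⊗ 𝐪 ^ᵖ n
      y≈0 = T.Ord≥-⊗ˡ {1} {𝐛} (𝐪 ^ᵖ n) 𝐛-Ord≥1
      y′≈0 = T.Ord≥-⊗ˡ {1} {𝐜} (𝐪 ^ᵖ n) 𝐜-Ord≥1

    Σ-X≈[]ratio⊗H : ∀ j k → Σ N (λ n → X n j k) T.≈[ N ] ratio ⊗ H j k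
    Σ-X≈[]ratio⊗H j k = begin
      Σ N (λ n → (β j ⊗ γ k) ⊗ φ₁₀-term A y n)
        ≈⟨ ΣN.*-distribˡ-Σ≤ N (β j ⊗ γ k) (φ₁₀-term A y) ⟨
      (β j ⊗ γ k) ⊗ Σ N (φ₁₀-term A y)
        ≈⟨ TN.*-congˡ (φ₁₀≈[]partial-sum A y≈0 N N≤1+N) ⟨
      (β j ⊗ γ k) ⊗ φ₁₀ A y
        ≈⟨ T.≋⇒≈[] (P.*-congˡ (φ₁₀-at-𝐳𝐪^ (j +ℕ k))) ⟩
      (β j ⊗ γ k) ⊗ (ratio ⊗ G (j +ℕ k))
        ≈⟨ T.≋⇒≈[] (x∙yz≈y∙xz (β j ⊗ γ k) ratio (G (j +ℕ k))) ⟩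
      ratio ⊗ H j k ∎
      where
      open CommutativeSemigroupProperties P.*-commutativeSemigroup using (x∙yz≈y∙xz)
      y = 𝐳 ⊗ 𝐪 ^ᵖ (j +ℕ k)
      y≈0 = T.Ord≥-⊗ˡ {1} {𝐳} (𝐪 ^ᵖ (j +ℕ k)) 𝐳-Ord≥1

    lhs≈[] : lhs a T.≈[ N ] (b∞ ⊗ c∞) ⊗ (ratio ⊗ square N)
    lhs≈[] = begin
      Σ∞ φ₃₂-term
        ≈⟨ TN.trans (Σ∞-truncate φ₃₂-term-summable N≤1+N) (ΣP≤≈[]Σ≤ N N φ₃₂-term) ⟩
      Σ N φ₃₂-term
        ≈⟨ ΣN.Σ≤-cong N (λ n → T.≋⇒≈[] (φ₃₂-term≋ n)) ⟩
      Σ N (λ n → (b∞ ⊗ c∞) ⊗ (t n ⊗ (E (𝐛 ⊗ 𝐪 ^ᵖ n) ⊗ E (𝐜 ⊗ 𝐪 ^ᵖ n))))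
        ≈⟨ ΣN.*-distribˡ-Σ≤ N (b∞ ⊗ c∞) _ ⟨
      (b∞ ⊗ c∞) ⊗ Σ N (λ n → t n ⊗ (E (𝐛 ⊗ 𝐪 ^ᵖ n) ⊗ E (𝐜 ⊗ 𝐪 ^ᵖ n)))
        ≈⟨ TN.*-congˡ (ΣN.Σ≤-cong N E⊗E≈[]double-sum) ⟩
      (b∞ ⊗ c∞) ⊗ Σ N (λ n → Σ N (λ j → Σ N (λ k → X n j k)))
        ≈⟨ TN.*-congˡ (TN.trans (ΣN.Σ≤-comm N N _) (ΣN.Σ≤-cong N (λ j → ΣN.Σ≤-comm N N _))) ⟩
      (b∞ ⊗ c∞) ⊗ Σ N (λ j → Σ N (λ k → Σ N (λ n → X n j k)))
        ≈⟨ TN.*-congˡ (ΣN.Σ≤-cong N (λ j → ΣN.Σ≤-cong N (Σ-X≈[]ratio⊗H j))) ⟩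
      (b∞ ⊗ c∞) ⊗ Σ N (λ j → Σ N (λ k → ratio ⊗ H j k))
        ≈⟨ TN.*-congˡ (TN.trans (ΣN.*-distribˡ-Σ≤ N ratio _) (ΣN.Σ≤-cong N (λ j → ΣN.*-distribˡ-Σ≤ N ratio (H j)))) ⟨
      (b∞ ⊗ c∞) ⊗ (ratio ⊗ square N) ∎

    rhs≈[] : rhs a T.≈[ N ] W ⊗ square N
    rhs≈[] = begin
      W ⊗ Σ∞ rhs-term
        ≈⟨ TN.*-congˡ (TN.trans (Σ∞-truncate rhs-term-summable N≤1+N) (ΣP≤≈[]Σ≤ N N rhs-term)) ⟩
      W ⊗ Σ N rhs-term
        ≈⟨ TN.*-congˡ (ΣN.Σ≤-cong N λ m → TN.trans (T.≋⇒≈[] (rhs-term≋ m)) (TN.*-congʳ {G m} (ΣP≤≈[]Σ≤ N m _))) ⟩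
      W ⊗ Σ N (λ m → Σ m (λ k → γ k ⊗ β (m ∸ k)) ⊗ G m)
        ≈⟨ TN.*-congˡ (ΣN.Σ≤-cong N λ m → ΣN.*-distribʳ-Σ≤ m (G m) _) ⟩
      W ⊗ Σ N (λ m → Σ m (λ k → F k m))
        ≈⟨ TN.*-congˡ (Σ-triangle≈Σ-square N F F-Ord≥) ⟩
      W ⊗ Σ N (λ k → Σ N (λ j → F k (k +ℕ j)))
        ≈⟨ TN.*-congˡ (ΣN.Σ≤-cong N λ k → ΣN.Σ≤-cong N λ j → T.≋⇒≈[] (F≋H k j)) ⟩
      W ⊗ Σ N (λ k → Σ N (λ j → H j k))
        ≈⟨ TN.*-congˡ (ΣN.Σ≤-comm N N (λ k j → H j k)) ⟩
      W ⊗ square N ∎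

mainTheorem15 : ∀ {c ℓ} (R : CommutativeRing c ℓ) (a : CommutativeRing.Carrier R) →
    Series._≋_ R (Series.lhs R a) (Series.rhs R a)
mainTheorem15 R a = T.≈[]-all⇒≋ λ N →
  let open SetoidReasoning (CommutativeRing.setoid (T.truncRing N)) in begin
    lhs a                            ≈⟨ lhs≈[] N ⟩
    (b∞ ⊗ c∞) ⊗ (ratio ⊗ square N)   ≈⟨ T.≋⇒≈[] (lhs-factor≋rhs-factor (square N)) ⟩
    W ⊗ square N                     ≈⟨ rhs≈[] N ⟨
    rhs a                            ∎
  where
  open Series R
  open Truncation R
  open Expansion R a
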